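{- Let $p\geq3$ be a prime and $1\leq i\leq p-1$ an integer. Then $$\sum_{m=1}^p\frac{(p-1)!}{(p-m)!\,(i+p)!}\left\{{i+p\atop m}\right\}_{\leq p-1}\equiv\begin{cases}0,& i=1,\\ \frac{(-1)^i}{i!\cdot i},& 2\leq i\leq p-1,\end{cases}\pmod p.$$
   Context: For integers $n\geq k\geq0$ and $r\geq1$, $\left\{{n\atop k}\right\}_{\leq r}$ denotes the $r$-restricted Stirling number of the second kind: the number of partitions of an $n$-element set into $k$ nonempty blocks each of size at most $r$; equivalently $\frac{1}{k!}\left(\sum_{m=1}^r\frac{t^m}{m!}\right)^k=\sum_{n\geq k}\left\{{n\atop k}\right\}_{\leq r}\frac{t^n}{n!}$. The congruence is in $\mathbb{Z}_{(p)}$ (the left side lies in $\mathbb{Z}_{(p)}$), meaning the difference lies in $p\mathbb{Z}_{(p)}$. -}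

module Defs where

open import Data.Nat using (ℕ; zero; suc; _!; _+_; _*_; _∸_; _≤ᵇ_; NonZero)
open import Data.Nat.Properties using (m*n≢0; _!*_!≢0; _!≢0)
open import Data.Nat.Combinatorics using (_C_)
open import Data.Nat.Divisibility using (_∣_)
open import Data.Integer as ℤ using (ℤ; +_; -[1+_]; ∣_∣)
open import Data.Rational as ℚ using (ℚ; 0ℚ; ↥_; ↧ₙ_; _/_; _-_)
open import Data.List using (List; map; upTo; foldr)
open import Data.Bool using (if_then_else_)
open import Data.Product using (_×_)
open import Relation.Nullary using (¬_)

Σℕ[<_] : ℕ → (ℕ → ℕ) → ℕ
Σℕ[< n ] f = foldr _+_ 0 (map f (upTo n))

Σℚ[<_] : ℕ → (ℕ → ℚ) → ℚ
Σℚ[< n ] f = foldr ℚ._+_ 0ℚ (map f (upTo n))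

-- r-restricted Stirling numbers of the second kind  S r n k = {n atop k}_{<= r}:
-- number of partitions of an n-set into k nonempty blocks of size <= r.
-- Defined by the standard recurrence obtained by removing the block that
-- contains the element 1: that block has j+1 elements (0 <= j <= n, j+1 <= r),
-- the j other elements are chosen in (n C j) ways, and the remaining n-j
-- elements are partitioned into k blocks.
S≤ : ℕ → ℕ → ℕ → ℕ
S≤ r zero    zero    = 1
S≤ r zero    (suc k) = 0
S≤ r (suc n) zero    = 0
S≤ r (suc n) (suc k) =
  Σℕ[< suc n ] (λ j → if suc j ≤ᵇ r then (n C j) * S≤ r (n ∸ j) k else 0)

-- Congruence modulo p in Z_(p): the difference x - y, written in lowest terms
-- a/b, has p ∣ a and p ∤ b (i.e. x - y ∈ p Z_(p)).
_≡_[modℚ_] : ℚ → ℚ → ℕ → Set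
x ≡ y [modℚ p ] = (p ∣ ∣ ↥ (x - y) ∣) × ¬ (p ∣ ↧ₙ (x - y))

term : ℕ → ℕ → ℕ → ℚ
term p i m =
  (+ ((p ∸ 1) ! * S≤ (p ∸ 1) (i + p) m)) / ((p ∸ m) ! * (i + p) !)
  where instance _ = (p ∸ m) !* (i + p) !≢0

lhs : ℕ → ℕ → ℚ
lhs p i = Σℚ[< p ] (λ j → term p i (suc j))

rhs : ℕ → ℚ
rhs zero = 0ℚ
rhs (suc zero) = 0ℚ
rhs (suc (suc k)) = (-[1+ 0 ] ℤ.^ i) / (i ! * i)
  where
  i = suc (suc k)
  instance _ = m*n≢0 (i !) i {{i !≢0}}

-- Write p = r + 1 and n = i + p.  Over the common denominator n!, the left-hand side has
-- numerator G = Σ_j r↓j · S≤r(n, j + 1), and counting the maps from an n-set to a p-set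
-- according to whether some fibre has more than r elements gives
-- G + Σ_{c ≤ i} C(n, c) r^c = p^(i + r).  Expanding r^c = (p − 1)^c ≡ (−1)^c (1 − c p)
-- (mod p²) and summing the alternating binomial series shows i G ≡ −(−1)^i p (mod p²) for
-- i ≥ 2 and G ≡ 0 (mod p²) for i = 1.  Finally n! = p · C(n, i) i! r! with C(n, i) ≡ 1 and
-- r! ≡ −1 (Wilson), so the difference of the two sides is a fraction whose numerator is
-- divisible by p² and whose denominator contains p exactly once.

module Submission where

open import Defs
open import Data.Nat using (ℕ; _≤_; _∸_)
open import Data.Nat.Primality using (Prime)
open import Algebra.Bundles using (CommutativeSemiring)
import Data.Nat.Properties
import Data.Integer.Properties

module FiniteSum {c ℓ} (R : CommutativeSemiring c ℓ) where
  open import Data.Fin using (toℕ)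
  open import Data.Fin.Properties using (toℕ<n)
  open import Data.Nat using (zero; suc; _<_; z≤n; s≤s; s<s)
  open import Function using (_∘_)
  open CommutativeSemiring R
  open import Algebra.Properties.Semiring.Sum semiring
    using (sum; sum-cong-≋; sum-replicate-zero; ∑-distrib-+; ∑-comm; *-distribˡ-sum; *-distribʳ-sum)
  open import Relation.Binary.Reasoning.Setoid setoid

  -- ∑< n f = f 0 + … + f (n ∸ 1) is the library's sum over Fin n, kept opaque so that
  -- unification sees the summand f; ∑<-suc is its defining equation.
  opaque
    ∑< : ℕ → (ℕ → Carrier) → Carrier
    ∑< n f = sum {n} (f ∘ toℕ)

    ∑<-sum : ∀ n f → ∑< n f ≈ sum {n} (f ∘ toℕ)
    ∑<-sum n f = refl

    ∑<-[] : ∀ f → ∑< 0 f ≈ 0#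
    ∑<-[] f = refl

    ∑<-suc : ∀ n f → ∑< (suc n) f ≈ f 0 + ∑< n (f ∘ suc)
    ∑<-suc n f = refl

    ∑<-cong : ∀ n {f g : ℕ → Carrier} → (∀ k → k < n → f k ≈ g k) → ∑< n f ≈ ∑< n g
    ∑<-cong n f≈g = sum-cong-≋ (λ k → f≈g (toℕ k) (toℕ<n k))

    ∑<-zero : ∀ n {f : ℕ → Carrier} → (∀ k → k < n → f k ≈ 0#) → ∑< n f ≈ 0#
    ∑<-zero n f≈0 = trans (∑<-cong n f≈0) (sum-replicate-zero n)

    ∑<-distrib-+ : ∀ n (f g : ℕ → Carrier) → ∑< n (λ k → f k + g k) ≈ ∑< n f + ∑< n g
    ∑<-distrib-+ n f g = ∑-distrib-+ {n} (f ∘ toℕ) (g ∘ toℕ)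

    *-distribˡ-∑< : ∀ n x (f : ℕ → Carrier) → x * ∑< n f ≈ ∑< n (λ k → x * f k)
    *-distribˡ-∑< n x f = *-distribˡ-sum {n} x (f ∘ toℕ)

    *-distribʳ-∑< : ∀ n x (f : ℕ → Carrier) → ∑< n f * x ≈ ∑< n (λ k → f k * x)
    *-distribʳ-∑< n x f = *-distribʳ-sum {n} x (f ∘ toℕ)

    ∑<-comm : ∀ m n (f : ℕ → ℕ → Carrier) →
      ∑< m (λ a → ∑< n (λ b → f a b)) ≈ ∑< n (λ b → ∑< m (λ a → f a b))
    ∑<-comm m n f = ∑-comm {m} {n} (λ a b → f (toℕ a) (toℕ b))

  ∑<-last : ∀ n (f : ℕ → Carrier) → ∑< (suc n) f ≈ ∑< n f + f n
  ∑<-last zero    f = begin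
    ∑< 1 f           ≈⟨ ∑<-suc 0 f ⟩
    f 0 + ∑< 0 (f ∘ suc) ≈⟨ +-congˡ (∑<-[] _) ⟩
    f 0 + 0#         ≈⟨ +-comm _ _ ⟩
    0# + f 0         ≈⟨ +-congʳ (∑<-[] f) ⟨
    ∑< 0 f + f 0     ∎
  ∑<-last (suc n) f = begin
    ∑< (suc (suc n)) f                 ≈⟨ ∑<-suc (suc n) f ⟩
    f 0 + ∑< (suc n) (f ∘ suc)         ≈⟨ +-congˡ (∑<-last n (f ∘ suc)) ⟩
    f 0 + (∑< n (f ∘ suc) + f (suc n)) ≈⟨ +-assoc _ _ _ ⟨
    f 0 + ∑< n (f ∘ suc) + f (suc n)   ≈⟨ +-congʳ (∑<-suc n f) ⟨
    ∑< (suc n) f + f (suc n)           ∎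

  ∑<-pad : ∀ {m n} (f : ℕ → Carrier) → m ≤ n → (∀ k → m ≤ k → k < n → f k ≈ 0#) →
    ∑< m f ≈ ∑< n f
  ∑<-pad {zero}  {n}     f _         f≈0 = trans (∑<-[] f) (sym (∑<-zero n (λ k → f≈0 k z≤n)))
  ∑<-pad {suc m} {suc n} f (s≤s m≤n) f≈0 = begin
    ∑< (suc m) f         ≈⟨ ∑<-suc m f ⟩
    f 0 + ∑< m (f ∘ suc) ≈⟨ +-congˡ (∑<-pad (f ∘ suc) m≤n (λ k m≤k k<n → f≈0 (suc k) (s≤s m≤k) (s<s k<n))) ⟩
    f 0 + ∑< n (f ∘ suc) ≈⟨ ∑<-suc n f ⟨
    ∑< (suc n) f         ∎

  ∑<-reverse : ∀ n (f : ℕ → Carrier) → ∑< n f ≈ ∑< n (λ k → f (n ∸ suc k))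
  ∑<-reverse zero    f = trans (∑<-[] f) (sym (∑<-[] _))
  ∑<-reverse (suc n) f = begin
    ∑< (suc n) f                     ≈⟨ ∑<-last n f ⟩
    ∑< n f + f n                     ≈⟨ +-congʳ (∑<-reverse n f) ⟩
    ∑< n (λ k → f (n ∸ suc k)) + f n ≈⟨ +-comm _ _ ⟩
    f n + ∑< n (λ k → f (n ∸ suc k)) ≈⟨ ∑<-suc n _ ⟨
    ∑< (suc n) (λ k → f (n ∸ k))     ∎

module ℕ∑ = FiniteSum Data.Nat.Properties.+-*-commutativeSemiring
module ℤ∑ = FiniteSum Data.Integer.Properties.+-*-commutativeSemiring

module BinomialCoefficients where

  open import Data.Nat as ℕ using (zero; suc; _+_; _*_; _^_; _!; _<_; _≤_; _∸_; s≤s; s<s)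
  import Data.Nat.Properties as ℕ
  open import Data.Nat.Properties
    using (_!≢0; _!*_!≢0; m*n≢0; *-cancelʳ-≡; m+n∸m≡n; ∸-+-assoc; +-∸-assoc; +-comm; *-comm; *-assoc;
           *-zeroʳ; ≤-trans; m≤m+n; +-suc; ≰⇒>; _≤?_; n<1+n; ∸-monoˡ-≤; m+[n∸m]≡n; module ≤-Reasoning)
  open import Data.Nat.Combinatorics using (_C_; nCk≡n!/k![n-k]!; k![n∸k]!∣n!; k>n⇒nCk≡0)
  open import Data.Nat.DivMod using (m/n*n≡m)
  open import Data.Nat.Tactic.RingSolver using (solve-∀)
  open import Data.List using (map; foldr; applyUpTo)
  open import Function using (_∘_)
  open import Relation.Nullary using (yes; no)
  open import Relation.Binary.PropositionalEquality
  open ℕ∑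

  foldr-applyUpTo≡∑< : ∀ n (f g : ℕ → ℕ) → foldr _+_ 0 (map f (applyUpTo g n)) ≡ ∑< n (f ∘ g)
  foldr-applyUpTo≡∑< zero    f g = sym (∑<-[] (f ∘ g))
  foldr-applyUpTo≡∑< (suc n) f g =
    trans (cong (f (g 0) +_) (foldr-applyUpTo≡∑< n f (g ∘ suc))) (sym (∑<-suc n (f ∘ g)))

  Σℕ[<]≡∑< : ∀ n f → Σℕ[< n ] f ≡ ∑< n f
  Σℕ[<]≡∑< n f = foldr-applyUpTo≡∑< n f (λ k → k)

  module _ where
    open import Algebra.Definitions.RawSemiring ℕ.+-*-rawSemiring
      renaming (_^_ to _^ₛ_; _×_ to _×ₛ_)
    import Algebra.Properties.Semiring.Binomial ℕ.+-*-semiring as Binomial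

    ^ₛ≡^ : ∀ x n → x ^ₛ n ≡ x ^ n
    ^ₛ≡^ x zero    = refl
    ^ₛ≡^ x (suc n) = cong (x *_) (^ₛ≡^ x n)

    ×ₛ≡* : ∀ n x → n ×ₛ x ≡ n * x
    ×ₛ≡* zero    x = refl
    ×ₛ≡* (suc n) x = cong (x +_) (×ₛ≡* n x)

    binomial-theorem : ∀ z n → suc z ^ n ≡ ∑< (suc n) (λ k → (n C k) * z ^ (n ∸ k))
    binomial-theorem z n = begin
      suc z ^ n ≡⟨ sym (^ₛ≡^ (suc z) n) ⟩
      suc z ^ₛ n ≡⟨ Binomial.theorem 1 z (ℕ.*-comm 1 z) n ⟩
      Binomial.binomialExpansion 1 z n ≡⟨ ∑<-sum (suc n) _ ⟨
      ∑< (suc n) (λ k → (n C k) ×ₛ (1 ^ₛ k * z ^ₛ (n ∸ k))) ≡⟨ ∑<-cong (suc n) binomialTerm≡ ⟩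
      ∑< (suc n) (λ k → (n C k) * z ^ (n ∸ k)) ∎
      where
      open ≡-Reasoning
      binomialTerm≡ : ∀ k → k < suc n → (n C k) ×ₛ (1 ^ₛ k * z ^ₛ (n ∸ k)) ≡ (n C k) * z ^ (n ∸ k)
      binomialTerm≡ k _ = begin
        (n C k) ×ₛ (1 ^ₛ k * z ^ₛ (n ∸ k)) ≡⟨ ×ₛ≡* (n C k) _ ⟩
        (n C k) * (1 ^ₛ k * z ^ₛ (n ∸ k)) ≡⟨ cong₂ (λ a b → (n C k) * (a * b)) (trans (^ₛ≡^ 1 k) (ℕ.^-zeroˡ k)) (^ₛ≡^ z (n ∸ k)) ⟩
        (n C k) * (1 * z ^ (n ∸ k)) ≡⟨ cong ((n C k) *_) (ℕ.*-identityˡ _) ⟩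
        (n C k) * z ^ (n ∸ k) ∎

  nCk*k![n∸k]!≡n! : ∀ {n k} → k ≤ n → (n C k) * (k ! * (n ∸ k) !) ≡ n !
  nCk*k![n∸k]!≡n! {n} {k} k≤n =
    trans (cong (_* (k ! * (n ∸ k) !)) (nCk≡n!/k![n-k]! k≤n)) (m/n*n≡m (k![n∸k]!∣n! k≤n))
    where instance _ = k !* (n ∸ k) !≢0

  [a+b]Ca*a!b!≡[a+b]! : ∀ a b → ((a + b) C a) * (a ! * b !) ≡ (a + b) !
  [a+b]Ca*a!b!≡[a+b]! a b = subst (λ c → ((a + b) C a) * (a ! * c !) ≡ (a + b) !) (m+n∸m≡n a b) (nCk*k![n∸k]!≡n! (m≤m+n a b))

  C-absorption : ∀ n k → suc k * (suc n C suc k) ≡ suc n * (n C k)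
  C-absorption n k with k ≤? n
  ... | no  k≰n = trans (cong (suc k *_) (k>n⇒nCk≡0 (s<s (≰⇒> k≰n)))) (trans (*-zeroʳ (suc k))
                   (sym (trans (cong (suc n *_) (k>n⇒nCk≡0 (≰⇒> k≰n))) (*-zeroʳ (suc n)))))
  ... | yes k≤n = subst (λ m → suc k * (suc m C suc k) ≡ suc m * (m C k)) (m+[n∸m]≡n k≤n) (absorption k (n ∸ k))
    where
    absorption : ∀ a b → suc a * ((suc a + b) C suc a) ≡ (suc a + b) * ((a + b) C a)
    absorption a b = *-cancelʳ-≡ _ _ (a ! * b !) {{a !* b !≢0}} (begin
      suc a * X * (a ! * b !)          ≡⟨ regroup (suc a) X (a !) (b !) ⟩
      X * (suc a ! * b !)              ≡⟨ [a+b]Ca*a!b!≡[a+b]! (suc a) b ⟩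
      (suc a + b) !                    ≡⟨ cong ((suc a + b) *_) ([a+b]Ca*a!b!≡[a+b]! a b) ⟨
      (suc a + b) * (Y * (a ! * b !))  ≡⟨ *-assoc (suc a + b) Y _ ⟨
      (suc a + b) * Y * (a ! * b !)    ∎)
      where
      open ≡-Reasoning
      X = (suc a + b) C suc a
      Y = (a + b) C a
      regroup : ∀ s x f g → s * x * (f * g) ≡ x * ((s * f) * g)
      regroup = solve-∀

  C-consecutive : ∀ a b → suc a * ((suc a + b) C suc a) ≡ suc b * ((suc a + b) C a)
  C-consecutive a b = *-cancelʳ-≡ _ _ (a ! * b !) {{a !* b !≢0}} (begin
    suc a * X * (a ! * b !)     ≡⟨ regroupˡ (suc a) X (a !) (b !) ⟩
    X * (suc a ! * b !)         ≡⟨ [a+b]Ca*a!b!≡[a+b]! (suc a) b ⟩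
    (suc a + b) !               ≡⟨ cong _! (+-suc a b) ⟨
    (a + suc b) !               ≡⟨ [a+b]Ca*a!b!≡[a+b]! a (suc b) ⟨
    ((a + suc b) C a) * (a ! * suc b !) ≡⟨ cong (λ n → (n C a) * (a ! * suc b !)) (+-suc a b) ⟩
    Y * (a ! * suc b !)         ≡⟨ regroupʳ (suc b) Y (a !) (b !) ⟨
    suc b * Y * (a ! * b !)     ∎)
    where
    open ≡-Reasoning
    X = (suc a + b) C suc a
    Y = (suc a + b) C a
    regroupˡ : ∀ s x f g → s * x * (f * g) ≡ x * ((s * f) * g)
    regroupˡ = solve-∀
    regroupʳ : ∀ s y f g → s * y * (f * g) ≡ y * (f * (s * g))
    regroupʳ = solve-∀

  m<n+o⇒m∸n<o′ : ∀ {n b j} → b ≤ n → n < b + j → n ∸ b < j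
  m<n+o⇒m∸n<o′ {n} {b} {j} b≤n n<b+j = begin-strict
    n ∸ b         <⟨ n<1+n (n ∸ b) ⟩
    suc (n ∸ b)   ≡⟨ +-∸-assoc 1 b≤n ⟨
    suc n ∸ b     ≤⟨ ∸-monoˡ-≤ b n<b+j ⟩
    b + j ∸ b     ≡⟨ m+n∸m≡n b j ⟩
    j             ∎
    where open ≤-Reasoning

  trinomial : ℕ → ℕ → ℕ → ℕ
  trinomial n b j = (n C b) * ((n ∸ b) C j)

  trinomial-vanishes : ∀ n b j → n < b + j → trinomial n b j ≡ 0
  trinomial-vanishes n b j n<b+j with b ≤? n
  ... | yes b≤n = trans (cong ((n C b) *_) (k>n⇒nCk≡0 (m<n+o⇒m∸n<o′ b≤n n<b+j))) (*-zeroʳ (n C b))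
  ... | no  b≰n = cong (_* ((n ∸ b) C j)) (k>n⇒nCk≡0 (≰⇒> b≰n))

  trinomial*factorials≡n! : ∀ n b j → b + j ≤ n → trinomial n b j * (b ! * j ! * (n ∸ (b + j)) !) ≡ n !
  trinomial*factorials≡n! n b j b+j≤n = begin
    (n C b) * ((n ∸ b) C j) * (b ! * j ! * (n ∸ (b + j)) !)
      ≡⟨ cong (λ m → (n C b) * ((n ∸ b) C j) * (b ! * j ! * m !)) (∸-+-assoc n b j) ⟨
    (n C b) * ((n ∸ b) C j) * (b ! * j ! * (n ∸ b ∸ j) !)
      ≡⟨ regroup (n C b) ((n ∸ b) C j) (b !) (j !) ((n ∸ b ∸ j) !) ⟩
    (n C b) * (b ! * (((n ∸ b) C j) * (j ! * (n ∸ b ∸ j) !)))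
      ≡⟨ cong (λ m → (n C b) * (b ! * m)) (nCk*k![n∸k]!≡n! j≤n∸b) ⟩
    (n C b) * (b ! * (n ∸ b) !)
      ≡⟨ nCk*k![n∸k]!≡n! (≤-trans (m≤m+n b j) b+j≤n) ⟩
    n ! ∎
    where
    open ≡-Reasoning
    j≤n∸b : j ≤ n ∸ b
    j≤n∸b = subst (_≤ n ∸ b) (m+n∸m≡n b j) (∸-monoˡ-≤ b b+j≤n)
    regroup : ∀ x y f g h → x * y * (f * g * h) ≡ x * (f * (y * (g * h)))
    regroup = solve-∀

  trinomial-comm : ∀ n b j → trinomial n b j ≡ trinomial n j b
  trinomial-comm n b j with b + j ≤? n
  ... | yes b+j≤n = *-cancelʳ-≡ _ _ (b ! * j ! * (n ∸ (b + j)) !) {{nonZero}} (begin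
    trinomial n b j * (b ! * j ! * (n ∸ (b + j)) !)  ≡⟨ trinomial*factorials≡n! n b j b+j≤n ⟩
    n !                                              ≡⟨ trinomial*factorials≡n! n j b j+b≤n ⟨
    trinomial n j b * (j ! * b ! * (n ∸ (j + b)) !)
      ≡⟨ cong₂ (λ f m → trinomial n j b * (f * (n ∸ m) !)) (*-comm (j !) (b !)) (+-comm j b) ⟩
    trinomial n j b * (b ! * j ! * (n ∸ (b + j)) !)  ∎)
    where
    open ≡-Reasoning
    nonZero = m*n≢0 _ _ {{b !* j !≢0}} {{(n ∸ (b + j)) !≢0}}
    j+b≤n = subst (_≤ n) (+-comm b j) b+j≤n
  ... | no b+j≰n = trans (trinomial-vanishes n b j (≰⇒> b+j≰n))
    (sym (trinomial-vanishes n j b (subst (n <_) (+-comm b j) (≰⇒> b+j≰n))))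

  binomial-theorem-padded : ∀ z {m n} → m ≤ n → suc z ^ m ≡ ∑< (suc n) (λ j → (m C j) * z ^ (m ∸ j))
  binomial-theorem-padded z {m} m≤n = trans (binomial-theorem z m)
    (∑<-pad _ (s≤s m≤n) (λ j m<j _ → cong (_* z ^ (m ∸ j)) (k>n⇒nCk≡0 m<j)))

module RestrictedStirling where

  open BinomialCoefficients
  open import Data.Bool using (true; false; if_then_else_)
  open import Data.Nat as ℕ using (zero; suc; _+_; _*_; _^_; _!; _<_; _≤_; _∸_; _≤ᵇ_; s≤s; s<s)
  open import Data.Nat.Properties as ℕ
    using (≤-refl; ≤-trans; <-≤-trans; m∸n≤m; n≤1+n; +-∸-assoc; *-zeroʳ; *-assoc; ∸-+-assoc; +-comm; +-assoc;
           +-identityʳ; *-distribˡ-+; *-distribʳ-+; ≤ᵇ-reflects-≤; ≰⇒>; m≤m+n; +-suc; m+n∸m≡n; ∸-monoʳ-≤; m∸[m∸n]≡n; <⇒≱)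
  open import Algebra.Properties.CommutativeSemigroup ℕ.*-commutativeSemigroup using (x∙yz≈y∙xz)
  open import Data.Nat.Combinatorics using (_C_; k>n⇒nCk≡0; nCk+nC[k+1]≡[n+1]C[k+1]; nCk≡nC[n∸k])
  open import Data.Empty using (⊥-elim)
  open import Data.Nat.Tactic.RingSolver using (solve-∀)
  open import Function using (_∘_)
  open import Relation.Nullary.Reflects using (ofʸ; ofⁿ)
  open import Relation.Binary.PropositionalEquality
  open ℕ∑

  infix 8 _↓_

  _↓_ : ℕ → ℕ → ℕ
  x     ↓ zero  = 1
  zero  ↓ suc k = 0
  suc x ↓ suc k = suc x * x ↓ k

  ↓-vanishes : ∀ {x k} → x < k → x ↓ k ≡ 0
  ↓-vanishes {zero}  {suc k} _           = refl
  ↓-vanishes {suc x} {suc k} (s<s x<k) = trans (cong (suc x *_) (↓-vanishes x<k)) (*-zeroʳ (suc x))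

  ↓-factorial : ∀ {x k} → k ≤ x → x ↓ k * (x ∸ k) ! ≡ x !
  ↓-factorial {x}     {zero}  _         = +-identityʳ (x !)
  ↓-factorial {suc x} {suc k} (s≤s k≤x) = trans (*-assoc (suc x) (x ↓ k) _) (cong (suc x *_) (↓-factorial k≤x))

  *-if : ∀ b c x → c * (if b then x else 0) ≡ (if b then c * x else 0)
  *-if true  c x = refl
  *-if false c x = *-zeroʳ c

  if-0 : ∀ b {x} → x ≡ 0 → (if b then x else 0) ≡ 0
  if-0 true  x≡0 = x≡0
  if-0 false _   = refl

  S≤-suc : ∀ r n k → S≤ r (suc n) (suc k) ≡ ∑< (suc n) (λ j → if suc j ≤ᵇ r then (n C j) * S≤ r (n ∸ j) k else 0)
  S≤-suc r n k = Σℕ[<]≡∑< (suc n) _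

  S≤-vanishes : ∀ r {m k} → m < k → S≤ r m k ≡ 0
  S≤-vanishes r {m} = go m ≤-refl
    where
    go : ∀ M {m k} → m ≤ M → m < k → S≤ r m k ≡ 0
    go M       {zero}  {suc k} _         _         = refl
    go (suc M) {suc m} {suc k} (s≤s m≤M) (s<s m<k) = trans (S≤-suc r m k) (∑<-zero (suc m) vanishing)
      where
      vanishing : ∀ j → j < suc m → (if suc j ≤ᵇ r then (m C j) * S≤ r (m ∸ j) k else 0) ≡ 0
      vanishing j _ = if-0 (suc j ≤ᵇ r) (trans (cong ((m C j) *_)
        (go M (≤-trans (m∸n≤m m j) m≤M) (<-≤-trans (s≤s (m∸n≤m m j)) m<k))) (*-zeroʳ (m C j)))

  -- boundedMaps r n x counts the maps from an n-set to an x-set all of whose fibres have at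
  -- most r elements, and x * overfullMaps r n (x ∸ 1) those with a fibre of more than r
  -- elements; for n ≤ 2r + 1 there is at most one such fibre, whence boundedMaps+overfullMaps≡^.
  boundedMaps : ℕ → ℕ → ℕ → ℕ
  boundedMaps r n x = ∑< (suc n) (λ k → S≤ r n k * x ↓ k)

  boundedMaps-pad : ∀ r {m n} y → m ≤ n → ∑< (suc n) (λ k → S≤ r m k * y ↓ k) ≡ boundedMaps r m y
  boundedMaps-pad r {m} y m≤n = sym (∑<-pad _ (s≤s m≤n) (λ k m<k _ → cong (_* y ↓ k) (S≤-vanishes r m<k)))

  boundedMaps-suc : ∀ r n y → boundedMaps r (suc n) (suc y) ≡
    suc y * ∑< (suc n) (λ j → if suc j ≤ᵇ r then (n C j) * boundedMaps r (n ∸ j) y else 0)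
  boundedMaps-suc r n y = begin
    boundedMaps r (suc n) (suc y)
      ≡⟨ ∑<-suc (suc n) _ ⟩
    ∑< (suc n) (λ k → S≤ r (suc n) (suc k) * (suc y * y ↓ k))
      ≡⟨ ∑<-cong (suc n) (λ k _ → x∙yz≈y∙xz (S≤ r (suc n) (suc k)) (suc y) (y ↓ k)) ⟩
    ∑< (suc n) (λ k → suc y * (S≤ r (suc n) (suc k) * y ↓ k))
      ≡⟨ *-distribˡ-∑< (suc n) (suc y) _ ⟨
    suc y * ∑< (suc n) (λ k → S≤ r (suc n) (suc k) * y ↓ k)
      ≡⟨ cong (suc y *_) (∑<-cong (suc n) (λ k _ →
           trans (cong (_* y ↓ k) (S≤-suc r n k)) (*-distribʳ-∑< (suc n) (y ↓ k) (block k)))) ⟩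
    suc y * ∑< (suc n) (λ k → ∑< (suc n) (λ j → block k j * y ↓ k))
      ≡⟨ cong (suc y *_) (∑<-comm (suc n) (suc n) (λ k j → block k j * y ↓ k)) ⟩
    suc y * ∑< (suc n) (λ j → ∑< (suc n) (λ k → block k j * y ↓ k))
      ≡⟨ cong (suc y *_) (∑<-cong (suc n) (λ j _ → blocks-containing-first (suc j ≤ᵇ r) j)) ⟩
    suc y * ∑< (suc n) (λ j → if suc j ≤ᵇ r then (n C j) * boundedMaps r (n ∸ j) y else 0) ∎
    where
    open ≡-Reasoning
    block : ℕ → ℕ → ℕ
    block k j = if suc j ≤ᵇ r then (n C j) * S≤ r (n ∸ j) k else 0
    blocks-containing-first : ∀ b j →
      ∑< (suc n) (λ k → (if b then (n C j) * S≤ r (n ∸ j) k else 0) * y ↓ k) ≡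
      (if b then (n C j) * boundedMaps r (n ∸ j) y else 0)
    blocks-containing-first false j = ∑<-zero (suc n) (λ _ _ → refl)
    blocks-containing-first true  j = begin
      ∑< (suc n) (λ k → (n C j) * S≤ r (n ∸ j) k * y ↓ k)
        ≡⟨ ∑<-cong (suc n) (λ k _ → *-assoc (n C j) _ _) ⟩
      ∑< (suc n) (λ k → (n C j) * (S≤ r (n ∸ j) k * y ↓ k))
        ≡⟨ *-distribˡ-∑< (suc n) (n C j) _ ⟨
      (n C j) * ∑< (suc n) (λ k → S≤ r (n ∸ j) k * y ↓ k)
        ≡⟨ cong ((n C j) *_) (boundedMaps-pad r y (m∸n≤m n j)) ⟩
      (n C j) * boundedMaps r (n ∸ j) y ∎

  overfullMaps : ℕ → ℕ → ℕ → ℕ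
  overfullMaps r n y = ∑< (suc n) (λ b → if b ≤ᵇ r then 0 else (n C b) * y ^ (n ∸ b))

  -- Both sides expand to the sum of the trinomial terms over b > r; the restriction j < r on
  -- the right is automatic there, since b + j ≤ n ≤ 2r.
  overfullMaps-suc : ∀ r n z → n ≤ r + r → overfullMaps r n (suc z) ≡
    ∑< (suc n) (λ j → if suc j ≤ᵇ r then (n C j) * overfullMaps r (n ∸ j) z else 0)
  overfullMaps-suc r n z n≤2r = begin
    overfullMaps r n (suc z)                      ≡⟨ ∑<-cong (suc n) (λ b _ → expand-overfull b) ⟩
    ∑< (suc n) (λ b → ∑< (suc n) (λ j → L b j))   ≡⟨ ∑<-comm (suc n) (suc n) L ⟩
    ∑< (suc n) (λ j → ∑< (suc n) (λ b → L b j))   ≡⟨ ∑<-cong (suc n) (λ j _ → ∑<-cong (suc n) (λ b _ → L≡R b j)) ⟩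
    ∑< (suc n) (λ j → ∑< (suc n) (λ b → R j b))   ≡⟨ ∑<-cong (suc n) (λ j _ → expand-first-block j (suc j ≤ᵇ r)) ⟨
    ∑< (suc n) (λ j → if suc j ≤ᵇ r then (n C j) * overfullMaps r (n ∸ j) z else 0) ∎
    where
    open ≡-Reasoning
    L : ℕ → ℕ → ℕ
    L b j = if b ≤ᵇ r then 0 else (n C b) * (((n ∸ b) C j) * z ^ (n ∸ b ∸ j))
    R : ℕ → ℕ → ℕ
    R j b = if suc j ≤ᵇ r then (if b ≤ᵇ r then 0 else (n C j) * (((n ∸ j) C b) * z ^ (n ∸ j ∸ b))) else 0

    expand-overfull : ∀ b → (if b ≤ᵇ r then 0 else (n C b) * suc z ^ (n ∸ b)) ≡ ∑< (suc n) (L b)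
    expand-overfull b with b ≤ᵇ r
    ... | true  = sym (∑<-zero (suc n) (λ _ _ → refl))
    ... | false = trans (cong ((n C b) *_) (binomial-theorem-padded z (m∸n≤m n b))) (*-distribˡ-∑< (suc n) (n C b) _)

    expand-first-block : ∀ j c → (if c then (n C j) * overfullMaps r (n ∸ j) z else 0) ≡
      ∑< (suc n) (λ b → if c then (if b ≤ᵇ r then 0 else (n C j) * (((n ∸ j) C b) * z ^ (n ∸ j ∸ b))) else 0)
    expand-first-block j false = sym (∑<-zero (suc n) (λ _ _ → refl))
    expand-first-block j true  = begin
      (n C j) * overfullMaps r (n ∸ j) z
        ≡⟨ cong ((n C j) *_) (∑<-pad _ (s≤s (m∸n≤m n j)) (λ b n∸j<b _ → overfull-vanishes b n∸j<b)) ⟩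
      (n C j) * ∑< (suc n) (λ b → if b ≤ᵇ r then 0 else ((n ∸ j) C b) * z ^ (n ∸ j ∸ b))
        ≡⟨ *-distribˡ-∑< (suc n) (n C j) _ ⟩
      ∑< (suc n) (λ b → (n C j) * (if b ≤ᵇ r then 0 else ((n ∸ j) C b) * z ^ (n ∸ j ∸ b)))
        ≡⟨ ∑<-cong (suc n) (λ b _ → *-unless (b ≤ᵇ r) (n C j) _) ⟩
      ∑< (suc n) (λ b → if b ≤ᵇ r then 0 else (n C j) * (((n ∸ j) C b) * z ^ (n ∸ j ∸ b))) ∎
      where
      overfull-vanishes : ∀ b → n ∸ j < b → (if b ≤ᵇ r then 0 else ((n ∸ j) C b) * z ^ (n ∸ j ∸ b)) ≡ 0
      overfull-vanishes b n∸j<b with b ≤ᵇ r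
      ... | true  = refl
      ... | false = cong (_* z ^ (n ∸ j ∸ b)) (k>n⇒nCk≡0 n∸j<b)
      *-unless : ∀ c x y → x * (if c then 0 else y) ≡ (if c then 0 else x * y)
      *-unless true  x y = *-zeroʳ x
      *-unless false x y = refl

    L≡R : ∀ b j → L b j ≡ R j b
    L≡R b j with b ≤ᵇ r | ≤ᵇ-reflects-≤ b r | suc j ≤ᵇ r | ≤ᵇ-reflects-≤ (suc j) r
    ... | true  | _        | true  | _        = refl
    ... | true  | _        | false | _        = refl
    ... | false | _        | true  | _        = begin
      (n C b) * (((n ∸ b) C j) * z ^ (n ∸ b ∸ j))  ≡⟨ *-assoc (n C b) _ _ ⟨
      (n C b) * ((n ∸ b) C j) * z ^ (n ∸ b ∸ j)    ≡⟨ cong₂ (λ c e → c * z ^ e) (trinomial-comm n b j) n∸b∸j≡n∸j∸b ⟩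
      (n C j) * ((n ∸ j) C b) * z ^ (n ∸ j ∸ b)    ≡⟨ *-assoc (n C j) _ _ ⟩
      (n C j) * (((n ∸ j) C b) * z ^ (n ∸ j ∸ b))  ∎
      where
      n∸b∸j≡n∸j∸b : n ∸ b ∸ j ≡ n ∸ j ∸ b
      n∸b∸j≡n∸j∸b = trans (∸-+-assoc n b j) (trans (cong (n ∸_) (+-comm b j)) (sym (∸-+-assoc n j b)))
    ... | false | ofⁿ b≰r | false | ofⁿ j≮r = begin
      (n C b) * (((n ∸ b) C j) * z ^ (n ∸ b ∸ j))  ≡⟨ *-assoc (n C b) _ _ ⟨
      (n C b) * ((n ∸ b) C j) * z ^ (n ∸ b ∸ j)    ≡⟨ cong (_* z ^ (n ∸ b ∸ j)) (trinomial-vanishes n b j n<b+j) ⟩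
      0 ∎
      where
      n<b+j : n < b + j
      n<b+j = ℕ.≤-<-trans n≤2r (ℕ.+-mono-<-≤ (≰⇒> b≰r) (ℕ.≮⇒≥ j≮r))

  overfullMaps-scaled : ∀ r n y →
    ∑< (suc n) (λ j → if suc j ≤ᵇ r then 0 else (n C suc j) * y ^ (n ∸ j)) ≡ y * overfullMaps r n y
  overfullMaps-scaled r n y = begin
    ∑< (suc n) (g ∘ suc)       ≡⟨ ∑<-suc (suc n) g ⟨
    ∑< (suc (suc n)) g         ≡⟨ ∑<-last (suc n) g ⟩
    ∑< (suc n) g + g (suc n)   ≡⟨ cong (∑< (suc n) g +_) last-vanishes ⟩
    ∑< (suc n) g + 0           ≡⟨ +-identityʳ _ ⟩
    ∑< (suc n) g               ≡⟨ ∑<-cong (suc n) shift ⟩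
    ∑< (suc n) (λ b → y * (if b ≤ᵇ r then 0 else (n C b) * y ^ (n ∸ b))) ≡⟨ *-distribˡ-∑< (suc n) y _ ⟨
    y * overfullMaps r n y     ∎
    where
    open ≡-Reasoning
    g : ℕ → ℕ
    g b = if b ≤ᵇ r then 0 else (n C b) * y ^ (suc n ∸ b)
    last-vanishes : g (suc n) ≡ 0
    last-vanishes with suc n ≤ᵇ r
    ... | true  = refl
    ... | false = cong (_* y ^ (n ∸ n)) (k>n⇒nCk≡0 (ℕ.n<1+n n))
    shift : ∀ b → b < suc n → g b ≡ y * (if b ≤ᵇ r then 0 else (n C b) * y ^ (n ∸ b))
    shift b (s≤s b≤n) with b ≤ᵇ r
    ... | true  = sym (*-zeroʳ y)
    ... | false = begin
      (n C b) * y ^ (suc n ∸ b)     ≡⟨ cong (λ e → (n C b) * y ^ e) (+-∸-assoc 1 b≤n) ⟩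
      (n C b) * (y * y ^ (n ∸ b))   ≡⟨ x∙yz≈y∙xz (n C b) y _ ⟩
      y * ((n C b) * y ^ (n ∸ b))   ∎

  overfullMaps-scaled-suc : ∀ r n y → n ≤ r + r → y * overfullMaps r n y ≡
    ∑< (suc n) (λ j → if suc j ≤ᵇ r then (n C j) * (y * overfullMaps r (n ∸ j) (y ∸ 1)) else 0)
  overfullMaps-scaled-suc r n zero    _     = sym (∑<-zero (suc n) (λ j _ → if-0 (suc j ≤ᵇ r) (*-zeroʳ (n C j))))
  overfullMaps-scaled-suc r n (suc z) n≤2r = begin
    suc z * overfullMaps r n (suc z)
      ≡⟨ cong (suc z *_) (overfullMaps-suc r n z n≤2r) ⟩
    suc z * ∑< (suc n) (λ j → if suc j ≤ᵇ r then (n C j) * overfullMaps r (n ∸ j) z else 0)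
      ≡⟨ *-distribˡ-∑< (suc n) (suc z) _ ⟩
    ∑< (suc n) (λ j → suc z * (if suc j ≤ᵇ r then (n C j) * overfullMaps r (n ∸ j) z else 0))
      ≡⟨ ∑<-cong (suc n) (λ j _ → trans (*-if (suc j ≤ᵇ r) (suc z) _)
           (cong (λ t → if suc j ≤ᵇ r then t else 0) (x∙yz≈y∙xz (suc z) (n C j) _))) ⟩
    ∑< (suc n) (λ j → if suc j ≤ᵇ r then (n C j) * (suc z * overfullMaps r (n ∸ j) z) else 0) ∎
    where
    open ≡-Reasoning

  boundedMaps+overfullMaps≡^ : ∀ r n x → n ≤ suc (r + r) →
    boundedMaps r n x + x * overfullMaps r n (x ∸ 1) ≡ x ^ n
  boundedMaps+overfullMaps≡^ r n x = go n n x ≤-refl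
    where
    go : ∀ N n x → n ≤ N → n ≤ suc (r + r) → boundedMaps r n x + x * overfullMaps r n (x ∸ 1) ≡ x ^ n
    go _ zero x _ _ = trans (cong₂ (λ a b → a + x * b)
      (trans (∑<-suc 0 _) (cong (1 +_) (∑<-[] _))) (trans (∑<-suc 0 _) (∑<-[] _)))
      (cong suc (*-zeroʳ x))
    go (suc N) (suc n) zero _ _ = trans (+-identityʳ _) (∑<-zero (suc (suc n)) no-maps)
      where
      no-maps : ∀ k → k < suc (suc n) → S≤ r (suc n) k * 0 ↓ k ≡ 0
      no-maps zero    _ = refl
      no-maps (suc k) _ = *-zeroʳ (S≤ r (suc n) (suc k))
    go (suc N) (suc n) (suc y) (s≤s n≤N) (s≤s n≤2r) = begin
      boundedMaps r (suc n) (suc y) + suc y * O    ≡⟨ cong (_+ suc y * O) (boundedMaps-suc r n y) ⟩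
      suc y * ∑< (suc n) a + suc y * O             ≡⟨ *-distribˡ-+ (suc y) _ O ⟨
      suc y * (∑< (suc n) a + O)                   ≡⟨ cong (λ t → suc y * (∑< (suc n) a + t)) overfull-split ⟩
      suc y * (∑< (suc n) a + (∑< (suc n) b + ∑< (suc n) c))
        ≡⟨ cong (suc y *_) (trans (sym (+-assoc (∑< (suc n) a) _ _))
             (cong (_+ ∑< (suc n) c) (sym (∑<-distrib-+ (suc n) a b)))) ⟩
      suc y * (∑< (suc n) (λ j → a j + b j) + ∑< (suc n) c)
        ≡⟨ cong (suc y *_) (∑<-distrib-+ (suc n) (λ j → a j + b j) c) ⟨
      suc y * ∑< (suc n) (λ j → a j + b j + c j)   ≡⟨ cong (suc y *_) (∑<-cong (suc n) binomial-term-split) ⟨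
      suc y * ∑< (suc n) (λ j → (n C j) * y ^ (n ∸ j)) ≡⟨ cong (suc y *_) (binomial-theorem y n) ⟨
      suc y * suc y ^ n ∎
      where
      open ≡-Reasoning
      O = overfullMaps r (suc n) y
      a b c d : ℕ → ℕ
      a j = if suc j ≤ᵇ r then (n C j) * boundedMaps r (n ∸ j) y else 0
      b j = if suc j ≤ᵇ r then (n C j) * (y * overfullMaps r (n ∸ j) (y ∸ 1)) else 0
      c j = if suc j ≤ᵇ r then 0 else (n C j) * y ^ (n ∸ j)
      d j = if suc j ≤ᵇ r then 0 else (n C suc j) * y ^ (n ∸ j)

      binomial-term-split : ∀ j → j < suc n → (n C j) * y ^ (n ∸ j) ≡ a j + b j + c j
      binomial-term-split j (s≤s j≤n) = split-on (suc j ≤ᵇ r) (begin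
        (n C j) * y ^ (n ∸ j)
          ≡⟨ cong ((n C j) *_) (go N (n ∸ j) y (≤-trans (m∸n≤m n j) n≤N) (≤-trans (m∸n≤m n j) (≤-trans n≤2r (n≤1+n _)))) ⟨
        (n C j) * (boundedMaps r (n ∸ j) y + y * overfullMaps r (n ∸ j) (y ∸ 1))
          ≡⟨ *-distribˡ-+ (n C j) _ _ ⟩
        (n C j) * boundedMaps r (n ∸ j) y + (n C j) * (y * overfullMaps r (n ∸ j) (y ∸ 1)) ∎)
        where
        split-on : ∀ t {u v w} → w ≡ u + v → w ≡ (if t then u else 0) + (if t then v else 0) + (if t then 0 else w)
        split-on true  w≡u+v = trans w≡u+v (sym (+-identityʳ _))
        split-on false _     = refl

      pascal-split : ∀ j → j < suc n → (if suc j ≤ᵇ r then 0 else (suc n C suc j) * y ^ (n ∸ j)) ≡ c j + d j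
      pascal-split j _ = unless-+ (suc j ≤ᵇ r)
        (trans (cong (_* y ^ (n ∸ j)) (sym (nCk+nC[k+1]≡[n+1]C[k+1] n j))) (*-distribʳ-+ (y ^ (n ∸ j)) (n C j) _))
        where
        unless-+ : ∀ t {u v w} → w ≡ u + v → (if t then 0 else w) ≡ (if t then 0 else u) + (if t then 0 else v)
        unless-+ true  _     = refl
        unless-+ false w≡u+v = w≡u+v

      overfull-split : O ≡ ∑< (suc n) b + ∑< (suc n) c
      overfull-split = begin
        O                                   ≡⟨ ∑<-suc (suc n) _ ⟩
        ∑< (suc n) (λ j → if suc j ≤ᵇ r then 0 else (suc n C suc j) * y ^ (n ∸ j))
                                            ≡⟨ ∑<-cong (suc n) pascal-split ⟩
        ∑< (suc n) (λ j → c j + d j)        ≡⟨ ∑<-distrib-+ (suc n) c d ⟩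
        ∑< (suc n) c + ∑< (suc n) d
          ≡⟨ cong (∑< (suc n) c +_) (trans (overfullMaps-scaled r n y) (overfullMaps-scaled-suc r n y n≤2r)) ⟩
        ∑< (suc n) c + ∑< (suc n) b         ≡⟨ +-comm (∑< (suc n) c) _ ⟩
        ∑< (suc n) b + ∑< (suc n) c         ∎

  lhsNumerator : ℕ → ℕ → ℕ
  lhsNumerator r i = ∑< (suc r) (λ j → r ↓ j * S≤ r (i + suc r) (suc j))

  partialBinomialSum : ℕ → ℕ → ℕ
  partialBinomialSum r i = ∑< (suc i) (λ c → ((i + suc r) C c) * r ^ c)

  boundedMaps-at-suc : ∀ r m → r ≤ m →
    boundedMaps r (suc m) (suc r) ≡ suc r * ∑< (suc r) (λ j → r ↓ j * S≤ r (suc m) (suc j))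
  boundedMaps-at-suc r m r≤m = begin
    boundedMaps r (suc m) (suc r)                                  ≡⟨ ∑<-suc (suc m) _ ⟩
    ∑< (suc m) (λ k → S≤ r (suc m) (suc k) * (suc r * r ↓ k))       ≡⟨ ∑<-pad _ (s≤s r≤m) (λ k r<k _ → too-many-blocks k r<k) ⟨
    ∑< (suc r) (λ k → S≤ r (suc m) (suc k) * (suc r * r ↓ k))
      ≡⟨ ∑<-cong (suc r) (λ k _ → regroup (S≤ r (suc m) (suc k)) (suc r) (r ↓ k)) ⟩
    ∑< (suc r) (λ k → suc r * (r ↓ k * S≤ r (suc m) (suc k)))       ≡⟨ *-distribˡ-∑< (suc r) (suc r) _ ⟨
    suc r * ∑< (suc r) (λ j → r ↓ j * S≤ r (suc m) (suc j))        ∎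
    where
    open ≡-Reasoning
    regroup : ∀ a b c → a * (b * c) ≡ b * (c * a)
    regroup = solve-∀
    too-many-blocks : ∀ k → r < k → S≤ r (suc m) (suc k) * (suc r * r ↓ k) ≡ 0
    too-many-blocks k r<k = trans (cong (λ t → S≤ r (suc m) (suc k) * (suc r * t)) (↓-vanishes r<k))
      (trans (cong (S≤ r (suc m) (suc k) *_) (*-zeroʳ (suc r))) (*-zeroʳ (S≤ r (suc m) (suc k))))

  overfullMaps≡partialBinomialSum : ∀ r i → overfullMaps r (i + suc r) r ≡ partialBinomialSum r i
  overfullMaps≡partialBinomialSum r i = begin
    ∑< (suc n) h                                 ≡⟨ ∑<-reverse (suc n) h ⟩
    ∑< (suc n) (λ c → h (n ∸ c))                 ≡⟨ ∑<-pad _ (s≤s (m≤m+n i (suc r))) (λ c i<c _ → not-overfull c i<c) ⟨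
    ∑< (suc i) (λ c → h (n ∸ c))                 ≡⟨ ∑<-cong (suc i) (λ c c≤i → reversed-term c c≤i) ⟩
    partialBinomialSum r i                       ∎
    where
    open ≡-Reasoning
    n = i + suc r
    h : ℕ → ℕ
    h b = if b ≤ᵇ r then 0 else (n C b) * r ^ (n ∸ b)
    n∸i≡1+r : n ∸ i ≡ suc r
    n∸i≡1+r = m+n∸m≡n i (suc r)
    n∸[1+i]≡r : n ∸ suc i ≡ r
    n∸[1+i]≡r = trans (cong (_∸ suc i) (+-suc i r)) (m+n∸m≡n (suc i) r)
    not-overfull : ∀ c → i < c → h (n ∸ c) ≡ 0
    not-overfull c i<c with n ∸ c ≤ᵇ r | ≤ᵇ-reflects-≤ (n ∸ c) r
    ... | true  | _         = refl
    ... | false | ofⁿ n∸c≰r = ⊥-elim (n∸c≰r (subst (n ∸ c ≤_) n∸[1+i]≡r (∸-monoʳ-≤ n i<c)))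
    reversed-term : ∀ c → c < suc i → h (n ∸ c) ≡ (n C c) * r ^ c
    reversed-term c (s≤s c≤i) with n ∸ c ≤ᵇ r | ≤ᵇ-reflects-≤ (n ∸ c) r
    ... | true  | ofʸ n∸c≤r = ⊥-elim (<⇒≱ (subst (_≤ n ∸ c) n∸i≡1+r (∸-monoʳ-≤ n c≤i)) n∸c≤r)
    ... | false | _         = cong₂ (λ k e → k * r ^ e) (sym (nCk≡nC[n∸k] c≤n)) (m∸[m∸n]≡n c≤n)
      where
      c≤n : c ≤ n
      c≤n = ≤-trans c≤i (m≤m+n i (suc r))

  lhsNumerator+partialBinomialSum≡p^[i+r] : ∀ r i → i ≤ r →
    lhsNumerator r i + partialBinomialSum r i ≡ suc r ^ (i + r)
  lhsNumerator+partialBinomialSum≡p^[i+r] r i i≤r = ℕ.*-cancelˡ-≡ _ _ (suc r) (begin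
    suc r * (G + K)                         ≡⟨ *-distribˡ-+ (suc r) G K ⟩
    suc r * G + suc r * K                   ≡⟨ cong₂ (λ a b → a + suc r * b) bounded overfull ⟨
    boundedMaps r n (suc r) + suc r * overfullMaps r n r ≡⟨ boundedMaps+overfullMaps≡^ r n (suc r) n≤1+2r ⟩
    suc r ^ n                               ≡⟨ cong (suc r ^_) (+-suc i r) ⟩
    suc r * suc r ^ (i + r)                 ∎)
    where
    open ≡-Reasoning
    n = i + suc r
    G = lhsNumerator r i
    K = partialBinomialSum r i
    n≤1+2r : n ≤ suc (r + r)
    n≤1+2r = subst (_≤ suc (r + r)) (sym (+-suc i r)) (s≤s (ℕ.+-monoˡ-≤ r i≤r))
    bounded : boundedMaps r n (suc r) ≡ suc r * G
    bounded = subst (λ m → boundedMaps r m (suc r) ≡ suc r * ∑< (suc r) (λ j → r ↓ j * S≤ r m (suc j)))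
      (sym (+-suc i r)) (boundedMaps-at-suc r (i + r) (ℕ.m≤n+m r i))
    overfull : overfullMaps r n r ≡ K
    overfull = overfullMaps≡partialBinomialSum r i

module IntegerCongruence where

  open import Data.Integer as ℤ using (ℤ; +_; _+_; _*_; -_; _-_; ∣_∣; 0ℤ)
  import Data.Integer.Properties as ℤ
  open import Data.Integer.Divisibility.Signed using (_∣_; divides; ∣m∣n⇒∣m+n; ∣m⇒∣-m; ∣n⇒∣m*n; ∣⇒∣ᵤ; ∣ᵤ⇒∣)
  open import Data.Integer.Tactic.RingSolver using (solve-∀)
  open import Data.Nat as ℕ using (ℕ; zero; suc; _<_)
  import Data.Nat.Divisibility as ℕ
  open import Level using (0ℓ)
  open import Relation.Binary.Bundles using (Setoid)
  open import Relation.Binary.PropositionalEquality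
  open ℤ∑

  infix 4 _≡_[modℤ_]

  record _≡_[modℤ_] (a b : ℤ) (m : ℕ) : Set where
    constructor modℤ
    field divides-difference : + m ∣ a - b

  module _ {m : ℕ} where

    private
      by : ∀ {a b c} → c ≡ a - b → + m ∣ c → a ≡ b [modℤ m ]
      by c≡a-b m∣c = modℤ (subst (+ m ∣_) c≡a-b m∣c)

    ≡⇒≡-modℤ : ∀ {a b} → a ≡ b → a ≡ b [modℤ m ]
    ≡⇒≡-modℤ {a} refl = modℤ (divides 0ℤ (ℤ.+-inverseʳ a))

    ≡-modℤ-refl : ∀ a → a ≡ a [modℤ m ]
    ≡-modℤ-refl a = ≡⇒≡-modℤ refl

    ≡-modℤ-sym : ∀ {a b} → a ≡ b [modℤ m ] → b ≡ a [modℤ m ]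
    ≡-modℤ-sym {a} {b} (modℤ a≡b) = by (negate a b) (∣m⇒∣-m a≡b)
      where
      negate : ∀ a b → - (a - b) ≡ b - a
      negate = solve-∀

    ≡-modℤ-trans : ∀ {a b c} → a ≡ b [modℤ m ] → b ≡ c [modℤ m ] → a ≡ c [modℤ m ]
    ≡-modℤ-trans {a} {b} {c} (modℤ a≡b) (modℤ b≡c) = by (telescope a b c) (∣m∣n⇒∣m+n a≡b b≡c)
      where
      telescope : ∀ a b c → a - b + (b - c) ≡ a - c
      telescope = solve-∀

    +-cong-modℤ : ∀ {a b c d} → a ≡ b [modℤ m ] → c ≡ d [modℤ m ] → a + c ≡ b + d [modℤ m ]
    +-cong-modℤ {a} {b} {c} {d} (modℤ a≡b) (modℤ c≡d) = by (regroup a b c d) (∣m∣n⇒∣m+n a≡b c≡d)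
      where
      regroup : ∀ a b c d → a - b + (c - d) ≡ a + c - (b + d)
      regroup = solve-∀

    -‿cong-modℤ : ∀ {a b} → a ≡ b [modℤ m ] → - a ≡ - b [modℤ m ]
    -‿cong-modℤ {a} {b} (modℤ a≡b) = by (negate a b) (∣m⇒∣-m a≡b)
      where
      negate : ∀ a b → - (a - b) ≡ - a - - b
      negate = solve-∀

    *-congˡ-modℤ : ∀ c {a b} → a ≡ b [modℤ m ] → c * a ≡ c * b [modℤ m ]
    *-congˡ-modℤ c {a} {b} (modℤ a≡b) = by (distrib c a b) (∣n⇒∣m*n c a≡b)
      where
      distrib : ∀ c a b → c * (a - b) ≡ c * a - c * b
      distrib = solve-∀

    *-congʳ-modℤ : ∀ c {a b} → a ≡ b [modℤ m ] → a * c ≡ b * c [modℤ m ]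
    *-congʳ-modℤ c {a} {b} a≡b = subst₂ (λ x y → x ≡ y [modℤ m ]) (ℤ.*-comm c a) (ℤ.*-comm c b) (*-congˡ-modℤ c a≡b)

    *-cong-modℤ : ∀ {a b c d} → a ≡ b [modℤ m ] → c ≡ d [modℤ m ] → a * c ≡ b * d [modℤ m ]
    *-cong-modℤ {b = b} {c = c} a≡b c≡d = ≡-modℤ-trans (*-congʳ-modℤ c a≡b) (*-congˡ-modℤ b c≡d)

    ∑<-cong-modℤ : ∀ n {f g : ℕ → ℤ} → (∀ k → k < n → f k ≡ g k [modℤ m ]) → ∑< n f ≡ ∑< n g [modℤ m ]
    ∑<-cong-modℤ zero    {f} {g} _   = ≡⇒≡-modℤ (trans (∑<-[] f) (sym (∑<-[] g)))
    ∑<-cong-modℤ (suc n) {f} {g} f≡g = subst₂ (λ x y → x ≡ y [modℤ m ]) (sym (∑<-suc n f)) (sym (∑<-suc n g))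
      (+-cong-modℤ (f≡g 0 (ℕ.s≤s ℕ.z≤n)) (∑<-cong-modℤ n (λ k k<n → f≡g (suc k) (ℕ.s<s k<n))))

    ≡-modℤ-by-quotient : ∀ {a b} q → a ≡ b + q * + m → a ≡ b [modℤ m ]
    ≡-modℤ-by-quotient {a} {b} q a≡b+qm = modℤ (divides q (begin
      a - b             ≡⟨ cong (_- b) a≡b+qm ⟩
      b + q * + m - b   ≡⟨ cancel b (q * + m) ⟩
      q * + m           ∎))
      where
      open ≡-Reasoning
      cancel : ∀ b x → b + x - b ≡ x
      cancel = solve-∀

    ∣⇒≡0-modℤ : ∀ {x} → m ℕ.∣ x → + x ≡ 0ℤ [modℤ m ]
    ∣⇒≡0-modℤ {x} m∣x = modℤ (subst (+ m ∣_) (sym (ℤ.+-identityʳ (+ x))) (∣ᵤ⇒∣ m∣x))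

    ≡0-modℤ⇒∣ : ∀ {a} → a ≡ 0ℤ [modℤ m ] → m ℕ.∣ ∣ a ∣
    ≡0-modℤ⇒∣ {a} (modℤ a≡0) = ∣⇒∣ᵤ (subst (+ m ∣_) (ℤ.+-identityʳ a) a≡0)

  modℤ-setoid : ℕ → Setoid 0ℓ 0ℓ
  modℤ-setoid m = record
    { Carrier = ℤ
    ; _≈_ = λ a b → a ≡ b [modℤ m ]
    ; isEquivalence = record { refl = ≡-modℤ-refl _ ; sym = ≡-modℤ-sym ; trans = ≡-modℤ-trans }
    }

  module ≡-modℤ-Reasoning (m : ℕ) where
    open import Relation.Binary.Reasoning.Setoid (modℤ-setoid m) public

  *-cong-modℤ-scaled : ∀ c {m a b} → a ≡ b [modℤ m ] → + c * a ≡ + c * b [modℤ c ℕ.* m ]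
  *-cong-modℤ-scaled c {m} {a} {b} (modℤ (divides q a-b≡qm)) = modℤ (divides q (begin
    + c * a - + c * b  ≡⟨ distrib (+ c) a b ⟩
    + c * (a - b)      ≡⟨ cong (+ c *_) a-b≡qm ⟩
    + c * (q * + m)    ≡⟨ regroup (+ c) q (+ m) ⟩
    q * (+ c * + m)    ≡⟨ cong (q *_) (ℤ.pos-* c m) ⟨
    q * + (c ℕ.* m)    ∎))
    where
    open ≡-Reasoning
    distrib : ∀ c a b → c * a - c * b ≡ c * (a - b)
    distrib = solve-∀
    regroup : ∀ c q m → c * (q * m) ≡ q * (c * m)
    regroup = solve-∀

module PrimeModulus where

  open BinomialCoefficients
  open IntegerCongruence
  open import Data.Nat as ℕ using (ℕ; zero; suc; _+_; _*_; _^_; _!; _<_; _≤_; _∸_; z≤n; s≤s; s<s; NonZero)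
  import Data.Nat.Properties as ℕ
  open import Data.Nat.Divisibility using (_∣_; ∣⇒≤; ∣-trans; m≤n⇒m!∣n!; m∣m*n; ∣m∣n⇒∣m+n; _∣0; ∣1⇒≡1; ∣m⇒∣m*n)
  open import Data.Integer.Divisibility.Signed using (∣⇒∣ᵤ; ∣ᵤ⇒∣)
  open import Data.Nat.Primality using (Prime; euclidsLemma; prime⇒nonZero; prime⇒nonTrivial)
  open import Data.Nat.Combinatorics using (_C_; nCk+nC[k+1]≡[n+1]C[k+1]; nCn≡1)
  open import Data.Integer as ℤ using (+_; _-_; 0ℤ; 1ℤ)
  import Data.Integer.Properties as ℤ
  open import Data.Integer.Tactic.RingSolver using (solve-∀)
  open import Data.Sum using (inj₁; inj₂)
  open import Data.Empty using (⊥-elim)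
  open import Function using (_∘_)
  open import Relation.Nullary using (¬_)
  open import Relation.Binary.PropositionalEquality
  open ℕ∑

  ∑<-∣ : ∀ {d} n {f : ℕ → ℕ} → (∀ k → k < n → d ∣ f k) → d ∣ ∑< n f
  ∑<-∣ {d} zero    {f} _   = subst (d ∣_) (sym (∑<-[] f)) (d ∣0)
  ∑<-∣ {d} (suc n) {f} d∣f = subst (d ∣_) (sym (∑<-suc n f))
    (∣m∣n⇒∣m+n (d∣f 0 (s≤s z≤n)) (∑<-∣ n (λ k k<n → d∣f (suc k) (s<s k<n))))

  +-∑< : ∀ n (f : ℕ → ℕ) → + ∑< n f ≡ ℤ∑.∑< n (+_ ∘ f)
  +-∑< zero    f = trans (cong +_ (∑<-[] f)) (sym (ℤ∑.∑<-[] _))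
  +-∑< (suc n) f = begin
    + ∑< (suc n) f                   ≡⟨ cong +_ (∑<-suc n f) ⟩
    + (f 0 + ∑< n (f ∘ suc))         ≡⟨ ℤ.pos-+ (f 0) _ ⟩
    + f 0 ℤ.+ + ∑< n (f ∘ suc)       ≡⟨ cong (ℤ._+_ (+ f 0)) (+-∑< n (f ∘ suc)) ⟩
    + f 0 ℤ.+ ℤ∑.∑< n (+_ ∘ f ∘ suc) ≡⟨ ℤ∑.∑<-suc n _ ⟨
    ℤ∑.∑< (suc n) (+_ ∘ f)           ∎
    where open ≡-Reasoning

  module _ {p} (p-prime : Prime p) where

    private instance
      p≢0 : NonZero p
      p≢0 = prime⇒nonZero p-prime

    p∤k : ∀ {k} → 0 < k → k < p → ¬ p ∣ k
    p∤k {suc k} _ k<p p∣k = ℕ.<⇒≱ k<p (∣⇒≤ p∣k)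

    p∤k! : ∀ {k} → k < p → ¬ p ∣ k !
    p∤k! {zero}  _   p∣1 = ℕ.<⇒≢ (ℕ.nonTrivial⇒n>1 p {{prime⇒nonTrivial p-prime}}) (sym (∣1⇒≡1 p∣1))
    p∤k! {suc k} k<p p∣k! with euclidsLemma (suc k) (k !) p-prime p∣k!
    ... | inj₁ p∣k  = p∤k (s≤s z≤n) k<p p∣k
    ... | inj₂ p∣k! = p∤k! (ℕ.<-trans (ℕ.n<1+n k) k<p) p∣k!

    p∤m*n : ∀ {m n} → ¬ p ∣ m → ¬ p ∣ n → ¬ p ∣ m * n
    p∤m*n {m} {n} p∤m p∤n p∣mn with euclidsLemma m n p-prime p∣mn
    ... | inj₁ p∣m = p∤m p∣m
    ... | inj₂ p∣n = p∤n p∣n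

    p∣C : ∀ {a b} → a < p → b < p → p ≤ a + b → p ∣ (a + b) C a
    p∣C {a} {b} a<p b<p p≤a+b with euclidsLemma ((a + b) C a) (a ! * b !) p-prime p∣C*a!b!
      where
      p∣C*a!b! : p ∣ ((a + b) C a) * (a ! * b !)
      p∣C*a!b! = subst (p ∣_) (sym ([a+b]Ca*a!b!≡[a+b]! a b)) (∣-trans (p∣p! p) (m≤n⇒m!∣n! p≤a+b))
        where
        p∣p! : ∀ p → .{{NonZero p}} → p ∣ p !
        p∣p! (suc q) = m∣m*n (q !)
    ... | inj₁ p∣C    = p∣C
    ... | inj₂ p∣a!b! = ⊥-elim (p∤m*n (p∤k! a<p) (p∤k! b<p) p∣a!b!)

    C[j+p,j]≡1 : ∀ {j} → j < p → + ((j + p) C j) ≡ 1ℤ [modℤ p ]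
    C[j+p,j]≡1 {zero}  _   = ≡⇒≡-modℤ refl
    C[j+p,j]≡1 {suc j} j<p = begin
      + ((suc j + p) C suc j)                          ≡⟨ cong +_ (nCk+nC[k+1]≡[n+1]C[k+1] (j + p) j) ⟨
      + ((j + p) C j) ℤ.+ + ((j + p) C suc j)          ≈⟨ +-cong-modℤ (C[j+p,j]≡1 (ℕ.<-trans (ℕ.n<1+n j) j<p)) (∣⇒≡0-modℤ p∣next) ⟩
      1ℤ ℤ.+ 0ℤ                                        ≡⟨⟩
      1ℤ                                               ∎
      where
      open ≡-modℤ-Reasoning p
      r = ℕ.pred p
      p≡1+r : p ≡ suc r
      p≡1+r = sym (ℕ.suc-pred p)
      p∣next : p ∣ (j + p) C suc j
      p∣next = subst (λ n → p ∣ n C suc j) (trans (sym (ℕ.+-suc j r)) (cong (λ n → j + n) (sym p≡1+r)))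
        (p∣C j<p (subst (r <_) (sym p≡1+r) (ℕ.n<1+n r)) (subst (_≤ suc j + r) (sym p≡1+r) (s≤s (ℕ.m≤n+m r j))))

    prime-cancel-modℤ : ∀ c {a b} → ¬ p ∣ ℤ.∣ c ∣ → c ℤ.* a ≡ c ℤ.* b [modℤ p ] → a ≡ b [modℤ p ]
    prime-cancel-modℤ c {a} {b} p∤c (modℤ p∣ca-cb) with euclidsLemma ℤ.∣ c ∣ ℤ.∣ a - b ∣ p-prime p∣∣c∣*∣a-b∣
      where
      factor : ∀ c a b → c ℤ.* a - c ℤ.* b ≡ c ℤ.* (a - b)
      factor = solve-∀
      p∣∣c∣*∣a-b∣ : p ∣ ℤ.∣ c ∣ * ℤ.∣ a - b ∣
      p∣∣c∣*∣a-b∣ = subst (p ∣_) (trans (cong ℤ.∣_∣ (factor c a b)) (ℤ.abs-* c (a - b))) (∣⇒∣ᵤ p∣ca-cb)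
    ... | inj₁ p∣c   = ⊥-elim (p∤c p∣c)
    ... | inj₂ p∣a-b = modℤ (∣ᵤ⇒∣ p∣a-b)

  freshmans-dream : ∀ {p} → Prime p → ∀ a → + (suc a ^ p) ≡ + (a ^ p) ℤ.+ 1ℤ [modℤ p ]
  freshmans-dream {suc r} p-prime a = ≡-modℤ-trans (≡⇒≡-modℤ (trans (cong +_ expansion) (ℤ.pos-+ (a ^ p) _)))
    (+-cong-modℤ (≡-modℤ-refl (+ (a ^ p))) (+-cong-modℤ (∣⇒≡0-modℤ p∣M) (≡-modℤ-refl 1ℤ)))
    where
    p = suc r
    f : ℕ → ℕ
    f k = (p C k) * a ^ (p ∸ k)
    M = ∑< r (f ∘ suc)
    expansion : suc a ^ p ≡ a ^ p + (M + 1)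
    expansion = begin
      suc a ^ p                     ≡⟨ binomial-theorem a p ⟩
      ∑< (suc p) f                  ≡⟨ ∑<-suc p f ⟩
      f 0 + ∑< p (f ∘ suc)          ≡⟨ cong₂ _+_ (ℕ.*-identityˡ (a ^ p)) (∑<-last r (f ∘ suc)) ⟩
      a ^ p + (M + f p)             ≡⟨ cong (λ t → a ^ p + (M + t)) (cong₂ (λ c e → c * a ^ e) (nCn≡1 p) (ℕ.n∸n≡0 p)) ⟩
      a ^ p + (M + 1)               ∎
      where open ≡-Reasoning
    p∣M : p ∣ M
    p∣M = ∑<-∣ r (λ k k<r → ∣m⇒∣m*n (a ^ (p ∸ suc k)) (subst (λ n → p ∣ n C suc k) (ℕ.m+[n∸m]≡n (s≤s (ℕ.<⇒≤ k<r)))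
      (p∣C p-prime (s<s k<r) (s≤s (ℕ.m∸n≤m r k)) (ℕ.≤-reflexive (sym (ℕ.m+[n∸m]≡n (s≤s (ℕ.<⇒≤ k<r))))))))

  fermat-prime-power : ∀ {p} → Prime p → ∀ a → + (a ^ p) ≡ + a [modℤ p ]
  fermat-prime-power {suc r} p-prime zero    = ≡⇒≡-modℤ refl
  fermat-prime-power {suc r} p-prime (suc a) = begin
    + (suc a ^ suc r)         ≈⟨ freshmans-dream p-prime a ⟩
    + (a ^ suc r) ℤ.+ 1ℤ      ≈⟨ +-cong-modℤ (fermat-prime-power p-prime a) (≡-modℤ-refl 1ℤ) ⟩
    + a ℤ.+ 1ℤ                ≡⟨ cong +_ (ℕ.+-comm a 1) ⟩
    + suc a                   ∎
    where open ≡-modℤ-Reasoning (suc r)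

  fermat : ∀ {p} → Prime p → ∀ {a} → 0 < a → a < p → + (a ^ (p ∸ 1)) ≡ 1ℤ [modℤ p ]
  fermat {suc r} p-prime {a} 0<a a<p = prime-cancel-modℤ p-prime (+ a) (p∤k p-prime 0<a a<p) (begin
    + a ℤ.* + (a ^ r)  ≡⟨ ℤ.pos-* a (a ^ r) ⟨
    + (a ^ suc r)      ≈⟨ fermat-prime-power p-prime a ⟩
    + a                ≡⟨ ℤ.*-identityʳ (+ a) ⟨
    + a ℤ.* 1ℤ         ∎)
    where open ≡-modℤ-Reasoning (suc r)

module WilsonTheorem where

  open BinomialCoefficients
  open IntegerCongruence
  open PrimeModulus
  open import Data.Nat as ℕ using (zero; suc; _!; _<_; z≤n; s≤s)
  import Data.Nat.Properties as ℕ
  open import Data.Nat.Combinatorics using (_C_; nCk+nC[k+1]≡[n+1]C[k+1]; k>n⇒nCk≡0; nC1≡n; nCn≡1)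
  open import Data.Nat.Primality using (Prime; composite; prime⇒nonTrivial)
  open import Relation.Nullary using (yes; no)
  import Data.Integer.Divisibility.Signed as ℤ∣
  open import Data.Nat.Divisibility using (divides)
  open import Data.Integer as ℤ using (ℤ; +_; _+_; _*_; -_; _-_; _^_; 0ℤ; 1ℤ; -1ℤ)
  import Data.Integer.Properties as ℤ
  open import Data.Integer.Tactic.RingSolver using (solve-∀)
  open import Data.Product using (∃-syntax; _,_)
  open import Data.Sum using (_⊎_; inj₁; inj₂)
  open import Data.Empty using (⊥-elim)
  open import Function using (_∘_)
  open import Relation.Binary.PropositionalEquality
  open ℤ∑

  alternating-sum : ∀ M i → ∑< (suc i) (λ c → -1ℤ ^ c * + (suc M C c)) ≡ -1ℤ ^ i * + (M C i)
  alternating-sum M zero    = trans (∑<-suc 0 _) (cong (λ s → 1ℤ + s) (∑<-[] _))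
  alternating-sum M (suc i) = begin
    ∑< (suc (suc i)) f                  ≡⟨ ∑<-last (suc i) f ⟩
    ∑< (suc i) f + f (suc i)            ≡⟨ cong₂ _+_ (alternating-sum M i) (cong (λ c → -1ℤ * -1ℤ ^ i * c) pascal) ⟩
    -1ℤ ^ i * + (M C i) + -1ℤ * -1ℤ ^ i * (+ (M C i) + + (M C suc i))
      ≡⟨ telescope (-1ℤ ^ i) (+ (M C i)) (+ (M C suc i)) ⟩
    -1ℤ * -1ℤ ^ i * + (M C suc i)       ∎
    where
    open ≡-Reasoning
    f : ℕ → ℤ
    f c = -1ℤ ^ c * + (suc M C c)
    pascal : + (suc M C suc i) ≡ + (M C i) + + (M C suc i)
    pascal = trans (cong +_ (sym (nCk+nC[k+1]≡[n+1]C[k+1] M i))) (ℤ.pos-+ (M C i) _)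
    telescope : ∀ s a b → s * a + -1ℤ * s * (a + b) ≡ -1ℤ * s * b
    telescope = solve-∀

  ∑<-neg : ∀ n (f : ℕ → ℤ) → ∑< n (λ k → - f k) ≡ - ∑< n f
  ∑<-neg n f = begin
    ∑< n (λ k → - f k)      ≡⟨ ∑<-cong n (λ k _ → ℤ.-1*i≡-i (f k)) ⟨
    ∑< n (λ k → -1ℤ * f k)  ≡⟨ *-distribˡ-∑< n -1ℤ f ⟨
    -1ℤ * ∑< n f            ≡⟨ ℤ.-1*i≡-i (∑< n f) ⟩
    - ∑< n f                ∎
    where open ≡-Reasoning

  Δ : ℕ → ℕ → ℕ → ℤ
  Δ n m y = ∑< (suc n) (λ k → -1ℤ ^ k * + (n C k) * + ((y ℕ.+ (n ℕ.∸ k)) ℕ.^ m))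

  Δ-suc : ∀ n m y → Δ (suc n) m y ≡ Δ n m (suc y) - Δ n m y
  Δ-suc n m y = begin
    Δ (suc n) m y
      ≡⟨ ∑<-suc (suc n) _ ⟩
    T 0 + ∑< (suc n) (λ k → -1ℤ ^ suc k * + (suc n C suc k) * + g (suc k))
      ≡⟨ cong (λ s → T 0 + s) (trans (∑<-cong (suc n) (λ k _ → pascal k)) (∑<-distrib-+ (suc n) U (T ∘ suc))) ⟩
    T 0 + (∑< (suc n) U + ∑< (suc n) (T ∘ suc))
      ≡⟨ regroup (T 0) (∑< (suc n) U) _ ⟩
    (T 0 + ∑< (suc n) (T ∘ suc)) + ∑< (suc n) U
      ≡⟨ cong₂ _+_ (sym (∑<-suc (suc n) T)) (∑<-neg (suc n) _) ⟩
    ∑< (suc (suc n)) T - Δ n m y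
      ≡⟨ cong (_- Δ n m y) (trans (∑<-last (suc n) T)
           (trans (cong (λ t → ∑< (suc n) T + t) last-vanishes) (ℤ.+-identityʳ (∑< (suc n) T)))) ⟩
    ∑< (suc n) T - Δ n m y
      ≡⟨ cong (_- Δ n m y) (∑<-cong (suc n) shift) ⟩
    Δ n m (suc y) - Δ n m y ∎
    where
    open ≡-Reasoning
    g : ℕ → ℕ
    g k = (y ℕ.+ (suc n ℕ.∸ k)) ℕ.^ m
    T U : ℕ → ℤ
    T k = -1ℤ ^ k * + (n C k) * + g k
    U k = - (-1ℤ ^ k * + (n C k) * + g (suc k))
    split : ∀ s a b x → -1ℤ * s * (a + b) * x ≡ - (s * a * x) + -1ℤ * s * b * x
    split = solve-∀
    pascal : ∀ k → -1ℤ ^ suc k * + (suc n C suc k) * + g (suc k) ≡ U k + T (suc k)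
    pascal k = trans (cong (λ c → -1ℤ ^ suc k * c * + g (suc k))
      (trans (cong +_ (sym (nCk+nC[k+1]≡[n+1]C[k+1] n k))) (ℤ.pos-+ (n C k) _))) (split (-1ℤ ^ k) _ _ _)
    regroup : ∀ a b c → a + (b + c) ≡ a + c + b
    regroup = solve-∀
    last-vanishes : T (suc n) ≡ 0ℤ
    last-vanishes = trans (cong (λ c → -1ℤ ^ suc n * + c * + g (suc n)) (k>n⇒nCk≡0 (ℕ.n<1+n n)))
      (trans (cong (_* + g (suc n)) (ℤ.*-zeroʳ (-1ℤ ^ suc n))) (ℤ.*-zeroˡ (+ g (suc n))))
    shift : ∀ k → k < suc n → T k ≡ -1ℤ ^ k * + (n C k) * + ((suc y ℕ.+ (n ℕ.∸ k)) ℕ.^ m)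
    shift k (s≤s k≤n) = cong (λ e → -1ℤ ^ k * + (n C k) * + (e ℕ.^ m))
      (trans (cong (y ℕ.+_) (ℕ.+-∸-assoc 1 k≤n)) (ℕ.+-suc y (n ℕ.∸ k)))

  Δ-shift : ∀ n m y → Δ n m (suc y) ≡ ∑< (suc m) (λ j → + (m C j) * Δ n (m ℕ.∸ j) y)
  Δ-shift n m y = begin
    Δ n m (suc y)                                    ≡⟨ ∑<-cong (suc n) (λ k _ → expand k) ⟩
    ∑< (suc n) (λ k → ∑< (suc m) (W k))              ≡⟨ ∑<-comm (suc n) (suc m) W ⟩
    ∑< (suc m) (λ j → ∑< (suc n) (λ k → W k j))      ≡⟨ ∑<-cong (suc m) (λ j _ → collect j) ⟩
    ∑< (suc m) (λ j → + (m C j) * Δ n (m ℕ.∸ j) y)  ∎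
    where
    open ≡-Reasoning
    X : ℕ → ℕ
    X k = y ℕ.+ (n ℕ.∸ k)
    W : ℕ → ℕ → ℤ
    W k j = -1ℤ ^ k * + (n C k) * (+ (m C j) * + (X k ℕ.^ (m ℕ.∸ j)))
    expand : ∀ k → -1ℤ ^ k * + (n C k) * + (suc (X k) ℕ.^ m) ≡ ∑< (suc m) (W k)
    expand k = begin
      -1ℤ ^ k * + (n C k) * + (suc (X k) ℕ.^ m)
        ≡⟨ cong (λ t → -1ℤ ^ k * + (n C k) * + t) (binomial-theorem (X k) m) ⟩
      -1ℤ ^ k * + (n C k) * + ℕ∑.∑< (suc m) (λ j → (m C j) ℕ.* X k ℕ.^ (m ℕ.∸ j))
        ≡⟨ cong (-1ℤ ^ k * + (n C k) *_) (trans (+-∑< (suc m) _) (∑<-cong (suc m) (λ j _ → ℤ.pos-* (m C j) _))) ⟩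
      -1ℤ ^ k * + (n C k) * ∑< (suc m) (λ j → + (m C j) * + (X k ℕ.^ (m ℕ.∸ j)))
        ≡⟨ *-distribˡ-∑< (suc m) (-1ℤ ^ k * + (n C k)) _ ⟩
      ∑< (suc m) (W k) ∎
    regroup : ∀ s c b x → s * c * (b * x) ≡ b * (s * c * x)
    regroup = solve-∀
    collect : ∀ j → ∑< (suc n) (λ k → W k j) ≡ + (m C j) * Δ n (m ℕ.∸ j) y
    collect j = trans (∑<-cong (suc n) (λ k _ → regroup (-1ℤ ^ k) (+ (n C k)) (+ (m C j)) _))
      (sym (*-distribˡ-∑< (suc n) (+ (m C j)) _))

  Δ-recurrence : ∀ n m y → Δ (suc n) m y ≡ ∑< m (λ j → + (m C suc j) * Δ n (m ℕ.∸ suc j) y)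
  Δ-recurrence n m y = begin
    Δ (suc n) m y                                   ≡⟨ Δ-suc n m y ⟩
    Δ n m (suc y) - Δ n m y                         ≡⟨ cong (_- Δ n m y) (trans (Δ-shift n m y) (∑<-suc m _)) ⟩
    1ℤ * Δ n m y + R - Δ n m y                      ≡⟨ cancel (Δ n m y) R ⟩
    R                                               ∎
    where
    open ≡-Reasoning
    R = ∑< m (λ j → + (m C suc j) * Δ n (m ℕ.∸ suc j) y)
    cancel : ∀ d r → 1ℤ * d + r - d ≡ r
    cancel = solve-∀

  Δ-vanishes : ∀ {n m} y → m < n → Δ n m y ≡ 0ℤ
  Δ-vanishes {suc n} {m} y (s≤s m≤n) = trans (Δ-recurrence n m y) (∑<-zero m (λ j j<m →
    trans (cong (+ (m C suc j) *_) (Δ-vanishes y (ℕ.<-≤-trans (ℕ.∸-monoʳ-< (s≤s z≤n) j<m) m≤n)))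
          (ℤ.*-zeroʳ (+ (m C suc j)))))

  Δ-diagonal : ∀ n y → Δ n n y ≡ + (n !)
  Δ-diagonal zero    y = trans (∑<-suc 0 _) (cong (λ s → 1ℤ + s) (∑<-[] _))
  Δ-diagonal (suc n) y = begin
    Δ (suc n) (suc n) y                               ≡⟨ trans (Δ-recurrence n (suc n) y) (∑<-suc n _) ⟩
    + (suc n C 1) * Δ n n y + ∑< n (λ j → + (suc n C suc (suc j)) * Δ n (n ℕ.∸ suc j) y)
      ≡⟨ cong₂ _+_ (cong₂ _*_ (cong +_ (nC1≡n (suc n))) (Δ-diagonal n y)) (∑<-zero n (λ j j<n →
           trans (cong (+ (suc n C suc (suc j)) *_) (Δ-vanishes y (ℕ.∸-monoʳ-< (s≤s z≤n) j<n)))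
                 (ℤ.*-zeroʳ (+ (suc n C suc (suc j)))))) ⟩
    + suc n * + (n !) + 0ℤ                            ≡⟨ ℤ.+-identityʳ _ ⟩
    + suc n * + (n !)                                 ≡⟨ ℤ.pos-* (suc n) (n !) ⟨
    + (suc n !)                                       ∎
    where open ≡-Reasoning

  -1^[n+n]≡1 : ∀ n → -1ℤ ^ (n ℕ.+ n) ≡ 1ℤ
  -1^[n+n]≡1 zero    = refl
  -1^[n+n]≡1 (suc n) = trans (cong (λ e → -1ℤ * -1ℤ ^ e) (ℕ.+-suc n n)) (trans (square (-1ℤ ^ (n ℕ.+ n))) (-1^[n+n]≡1 n))
    where
    square : ∀ x → -1ℤ * (-1ℤ * x) ≡ x
    square = solve-∀

  even-or-odd : ∀ n → ∃[ t ] (n ≡ t ℕ.+ t ⊎ n ≡ suc (t ℕ.+ t))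
  even-or-odd zero = 0 , inj₁ refl
  even-or-odd (suc n) with even-or-odd n
  ... | t , inj₁ n≡t+t = t , inj₂ (cong suc n≡t+t)
  ... | t , inj₂ n≡1+t+t = suc t , inj₁ (trans (cong suc n≡1+t+t) (cong suc (sym (ℕ.+-suc t t))))

  -- r! is the r-th difference of x ↦ x ^ r at 0, and Fermat turns every nonzero (r ∸ k) ^ r
  -- into 1, leaving an alternating binomial sum.
  wilson-odd : ∀ u → let r = suc u ℕ.+ suc u in Prime (suc r) → + (r !) ≡ -1ℤ [modℤ suc r ]
  wilson-odd u p-prime = begin
    + (r !)                                         ≡⟨ Δ-diagonal r 0 ⟨
    Δ r r 0                                         ≡⟨ ∑<-last r _ ⟩
    ∑< r f + f r                                    ≡⟨ cong (λ t → ∑< r f + t) last-vanishes ⟩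
    ∑< r f + 0ℤ                                     ≡⟨ ℤ.+-identityʳ _ ⟩
    ∑< r f                                          ≈⟨ ∑<-cong-modℤ r (λ k k<r → *-congˡ-modℤ (-1ℤ ^ k * + (r C k))
                                                         (fermat p-prime (ℕ.m<n⇒0<n∸m k<r) (s≤s (ℕ.m∸n≤m r k)))) ⟩
    ∑< r (λ k → -1ℤ ^ k * + (r C k) * 1ℤ)           ≡⟨ ∑<-cong r (λ k _ → ℤ.*-identityʳ _) ⟩
    ∑< (suc M) (λ k → -1ℤ ^ k * + (suc M C k))      ≡⟨ alternating-sum M M ⟩
    -1ℤ ^ M * + (M C M)                             ≡⟨ cong₂ (λ e c → -1ℤ ^ e * + c) (ℕ.+-suc u u) (nCn≡1 M) ⟩
    -1ℤ * -1ℤ ^ (u ℕ.+ u) * 1ℤ                      ≡⟨ cong (λ s → -1ℤ * s * 1ℤ) (-1^[n+n]≡1 u) ⟩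
    -1ℤ                                             ∎
    where
    r = suc u ℕ.+ suc u
    M = u ℕ.+ suc u
    open ≡-modℤ-Reasoning (suc r)
    f : ℕ → ℤ
    f k = -1ℤ ^ k * + (r C k) * + ((r ℕ.∸ k) ℕ.^ r)
    last-vanishes : f r ≡ 0ℤ
    last-vanishes = trans (cong (λ e → -1ℤ ^ r * + (r C r) * + (e ℕ.^ r)) (ℕ.n∸n≡0 r)) (ℤ.*-zeroʳ (-1ℤ ^ r * + (r C r)))

  wilson : ∀ {p} → Prime p → + ((p ℕ.∸ 1) !) ≡ -1ℤ [modℤ p ]
  wilson {p} p-prime with even-or-odd p
  ... | t , inj₂ refl with t
  ...   | zero  = ⊥-elim (ℕ.<-irrefl refl (ℕ.nonTrivial⇒n>1 1 {{prime⇒nonTrivial p-prime}}))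
  ...   | suc u = wilson-odd u p-prime
  wilson {p} p-prime | t , inj₁ p≡t+t with p ℕ.≟ 2
  ... | yes refl = modℤ (ℤ∣.divides 1ℤ refl)
  ... | no  p≢2  = ⊥-elim (Prime.notComposite p-prime (composite 2<p (divides t (trans p≡t+t (t+t≡t*2 t)))))
    where
    2<p : 2 < p
    2<p = ℕ.≤∧≢⇒< (ℕ.nonTrivial⇒n>1 p {{prime⇒nonTrivial p-prime}}) (p≢2 ∘ sym)
    t+t≡t*2 : ∀ t → t ℕ.+ t ≡ t ℕ.* 2
    t+t≡t*2 t = trans (cong (t ℕ.+_) (sym (ℕ.+-identityʳ t))) (ℕ.*-comm 2 t)

module ModPrimeSquare where

  open BinomialCoefficients
  open RestrictedStirling
  open IntegerCongruence
  open PrimeModulus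
  open WilsonTheorem
  open import Data.Nat as ℕ using (zero; suc; _≤_; s≤s)
  import Data.Nat.Properties as ℕ
  open import Data.Nat.Combinatorics using (_C_; nC1≡n)
  open import Data.Nat.Divisibility using (_∣_; divides)
  open import Data.Nat.Primality using (Prime)
  open import Data.Integer as ℤ using (ℤ; +_; _+_; _*_; -_; _-_; _^_; 0ℤ; 1ℤ; -1ℤ)
  import Data.Integer.Properties as ℤ
  open import Data.Integer.Tactic.RingSolver using (solve-∀)
  open import Function using (_∘_)
  open import Relation.Binary.PropositionalEquality
  open ℤ∑

  [p-1]^c≡[-1]^c[1-cp] : ∀ r c → + (r ℕ.^ c) ≡ -1ℤ ^ c * (1ℤ - + c * + suc r) [modℤ suc r ℕ.* suc r ]
  [p-1]^c≡[-1]^c[1-cp] r zero    = ≡-modℤ-refl 1ℤ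
  [p-1]^c≡[-1]^c[1-cp] r (suc c) = begin
    + (r ℕ.^ suc c)                               ≡⟨ ℤ.pos-* r (r ℕ.^ c) ⟩
    + r * + (r ℕ.^ c)                             ≈⟨ *-congˡ-modℤ (+ r) ([p-1]^c≡[-1]^c[1-cp] r c) ⟩
    + r * (-1ℤ ^ c * (1ℤ - + c * + suc r))        ≈⟨ ≡-modℤ-by-quotient (- (-1ℤ ^ c * + c)) (trans (expand (-1ℤ ^ c) (+ c) (+ r))
                                                       (cong (λ m → -1ℤ ^ suc c * (1ℤ - + suc c * + suc r) + - (-1ℤ ^ c * + c) * m)
                                                             (sym (ℤ.pos-* (suc r) (suc r))))) ⟩
    -1ℤ ^ suc c * (1ℤ - + suc c * + suc r)        ∎
    where
    open ≡-modℤ-Reasoning (suc r ℕ.* suc r)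
    expand : ∀ s c r → r * (s * (1ℤ - c * (1ℤ + r))) ≡
      -1ℤ * s * (1ℤ - (1ℤ + c) * (1ℤ + r)) + - (s * c) * ((1ℤ + r) * (1ℤ + r))
    expand = solve-∀

  ∑<-linear : ∀ n P (f g : ℕ → ℤ) → ∑< n (λ c → f c + - P * g c) ≡ ∑< n f - P * ∑< n g
  ∑<-linear n P f g = begin
    ∑< n (λ c → f c + - P * g c)        ≡⟨ ∑<-distrib-+ n f (λ c → - P * g c) ⟩
    ∑< n f + ∑< n (λ c → - P * g c)     ≡⟨ cong (λ s → ∑< n f + s) (*-distribˡ-∑< n (- P) g) ⟨
    ∑< n f + - P * ∑< n g               ≡⟨ cong (λ s → ∑< n f + s) (ℤ.neg-distribˡ-* P (∑< n g)) ⟨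
    ∑< n f - P * ∑< n g                 ∎
    where open ≡-Reasoning

  alternating-moment : ∀ M i →
    ∑< (suc (suc i)) (λ c → + c * (-1ℤ ^ c * + (suc (suc M) C c))) ≡ - + suc (suc M) * (-1ℤ ^ i * + (M C i))
  alternating-moment M i = begin
    ∑< (suc (suc i)) f
      ≡⟨ trans (∑<-suc (suc i) f) (cong (_+ ∑< (suc i) (f ∘ suc)) (ℤ.*-zeroˡ (1ℤ * + 1))) ⟩
    0ℤ + ∑< (suc i) (λ e → + suc e * (-1ℤ ^ suc e * + (N C suc e)))
      ≡⟨ trans (ℤ.+-identityˡ _) (∑<-cong (suc i) (λ e _ → absorb e)) ⟩
    ∑< (suc i) (λ e → - + N * (-1ℤ ^ e * + (suc M C e)))
      ≡⟨ *-distribˡ-∑< (suc i) (- + N) _ ⟨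
    - + N * ∑< (suc i) (λ e → -1ℤ ^ e * + (suc M C e))
      ≡⟨ cong (- + N *_) (alternating-sum M i) ⟩
    - + N * (-1ℤ ^ i * + (M C i)) ∎
    where
    open ≡-Reasoning
    N = suc (suc M)
    f : ℕ → ℤ
    f c = + c * (-1ℤ ^ c * + (N C c))
    regroup : ∀ e s C → e * (-1ℤ * s * C) ≡ -1ℤ * s * (e * C)
    regroup = solve-∀
    negate : ∀ s m C → -1ℤ * s * (m * C) ≡ - m * (s * C)
    negate = solve-∀
    absorb : ∀ e → + suc e * (-1ℤ ^ suc e * + (N C suc e)) ≡ - + N * (-1ℤ ^ e * + (suc M C e))
    absorb e = begin
      + suc e * (-1ℤ * -1ℤ ^ e * + (N C suc e))       ≡⟨ regroup (+ suc e) (-1ℤ ^ e) _ ⟩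
      -1ℤ * -1ℤ ^ e * (+ suc e * + (N C suc e))       ≡⟨ cong (-1ℤ * -1ℤ ^ e *_) (trans (sym (ℤ.pos-* (suc e) _))
                                                           (trans (cong +_ (C-absorption (suc M) e)) (ℤ.pos-* N (suc M C e)))) ⟩
      -1ℤ * -1ℤ ^ e * (+ N * + (suc M C e))           ≡⟨ negate (-1ℤ ^ e) (+ N) _ ⟩
      - + N * (-1ℤ ^ e * + (suc M C e))               ∎

  i*partialBinomialSum≡[-1]^i*p : ∀ {r i} → Prime (suc r) → 2 ≤ i → i ≤ r →
    + i * + partialBinomialSum r i ≡ -1ℤ ^ i * + suc r [modℤ suc r ℕ.* suc r ]
  i*partialBinomialSum≡[-1]^i*p {r} {i@(suc i′)} p-prime (s≤s 1≤i′) i≤r = begin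
    + i * + partialBinomialSum r i
      ≡⟨ cong (+ i *_) (trans (+-∑< (suc i) _) (∑<-cong (suc i) (λ c _ → binomial-term c))) ⟩
    + i * ∑< (suc i) (λ c → + (suc M C c) * + (r ℕ.^ c))
      ≈⟨ *-congˡ-modℤ (+ i) (∑<-cong-modℤ (suc i) (λ c _ → *-congˡ-modℤ (+ (suc M C c)) ([p-1]^c≡[-1]^c[1-cp] r c))) ⟩
    + i * ∑< (suc i) (λ c → + (suc M C c) * (-1ℤ ^ c * (1ℤ - + c * P)))
      ≡⟨ cong (+ i *_) (trans (∑<-cong (suc i) (λ c _ → split (+ (suc M C c)) (-1ℤ ^ c) (+ c) P)) (∑<-linear (suc i) P _ _)) ⟩
    + i * (A₁ - P * A₂)
      ≡⟨ distribute (+ i) A₁ P A₂ ⟩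
    + i * A₁ - P * (+ i * A₂)
      ≈⟨ +-cong-modℤ i*A₁≡[-1]^i*p (-‿cong-modℤ p*i*A₂≡0) ⟩
    -1ℤ ^ i * P - 0ℤ
      ≡⟨ ℤ.+-identityʳ _ ⟩
    -1ℤ ^ i * P ∎
    where
    open ≡-modℤ-Reasoning (suc r ℕ.* suc r)
    P = + suc r
    M = i ℕ.+ r
    A₁ = ∑< (suc i) (λ c → -1ℤ ^ c * + (suc M C c))
    A₂ = ∑< (suc i) (λ c → + c * (-1ℤ ^ c * + (suc M C c)))
    binomial-term : ∀ c → + (((i ℕ.+ suc r) C c) ℕ.* r ℕ.^ c) ≡ + (suc M C c) * + (r ℕ.^ c)
    binomial-term c = trans (cong (λ n → + ((n C c) ℕ.* r ℕ.^ c)) (ℕ.+-suc i r)) (ℤ.pos-* (suc M C c) _)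
    split : ∀ C s c P → C * (s * (1ℤ - c * P)) ≡ s * C + - P * (c * (s * C))
    split = solve-∀
    distribute : ∀ i A P B → i * (A - P * B) ≡ i * A - P * (i * B)
    distribute = solve-∀

    i*A₁≡[-1]^i*p : + i * A₁ ≡ -1ℤ ^ i * P [modℤ suc r ℕ.* suc r ]
    i*A₁≡[-1]^i*p = begin
      + i * A₁                                 ≡⟨ cong (+ i *_) (alternating-sum M i) ⟩
      + i * (-1ℤ ^ i * + (M C i))              ≡⟨ trans (regroup (+ i) (-1ℤ ^ i) _) (cong (-1ℤ ^ i *_) (sym (ℤ.pos-* i (M C i)))) ⟩
      -1ℤ ^ i * + (i ℕ.* (M C i))              ≡⟨ cong (λ t → -1ℤ ^ i * + t) (C-consecutive i′ r) ⟩
      -1ℤ ^ i * + (suc r ℕ.* ((suc i′ ℕ.+ r) C i′)) ≡⟨ cong (-1ℤ ^ i *_) (ℤ.pos-* (suc r) _) ⟩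
      -1ℤ ^ i * (P * + ((suc i′ ℕ.+ r) C i′))  ≈⟨ *-congˡ-modℤ (-1ℤ ^ i) (*-cong-modℤ-scaled (suc r)
                                                    (subst (λ n → + (n C i′) ≡ 1ℤ [modℤ suc r ]) (ℕ.+-suc i′ r)
                                                      (C[j+p,j]≡1 p-prime (ℕ.<-trans (ℕ.n<1+n i′) (s≤s i≤r))))) ⟩
      -1ℤ ^ i * (P * 1ℤ)                       ≡⟨ cong (-1ℤ ^ i *_) (ℤ.*-identityʳ P) ⟩
      -1ℤ ^ i * P                              ∎
      where
      regroup : ∀ i s c → i * (s * c) ≡ s * (i * c)
      regroup = solve-∀

    M′ = i′ ℕ.+ r
    p∣C[M′,i′] : suc r ∣ M′ C i′
    p∣C[M′,i′] = p∣C p-prime (ℕ.<-trans (ℕ.n<1+n i′) (s≤s i≤r)) (ℕ.n<1+n r) (ℕ.+-monoˡ-≤ r 1≤i′)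

    A₂≡0 : A₂ ≡ 0ℤ [modℤ suc r ]
    A₂≡0 = ≡-modℤ-trans (≡⇒≡-modℤ (alternating-moment M′ i′))
      (≡-modℤ-trans (*-congˡ-modℤ (- + suc M) (*-congˡ-modℤ (-1ℤ ^ i′) (∣⇒≡0-modℤ p∣C[M′,i′])))
        (≡⇒≡-modℤ (trans (cong (- + suc M *_) (ℤ.*-zeroʳ (-1ℤ ^ i′))) (ℤ.*-zeroʳ (- + suc M)))))

    p*i*A₂≡0 : P * (+ i * A₂) ≡ 0ℤ [modℤ suc r ℕ.* suc r ]
    p*i*A₂≡0 = ≡-modℤ-trans (*-cong-modℤ-scaled (suc r) (*-congˡ-modℤ (+ i) A₂≡0))
      (≡⇒≡-modℤ (trans (cong (P *_) (ℤ.*-zeroʳ (+ i))) (ℤ.*-zeroʳ P)))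

  p*p∣p^[2+k] : ∀ p k → p ℕ.* p ∣ p ℕ.^ (2 ℕ.+ k)
  p*p∣p^[2+k] p k = divides (p ℕ.^ k) (trans (sym (ℕ.*-assoc p p (p ℕ.^ k))) (ℕ.*-comm (p ℕ.* p) (p ℕ.^ k)))

  lhsNumerator≡-partialBinomialSum : ∀ {r i} → 1 ≤ i → i ≤ r →
    + lhsNumerator r i ≡ - + partialBinomialSum r i [modℤ suc r ℕ.* suc r ]
  lhsNumerator≡-partialBinomialSum {zero}         {suc _}      _ ()
  lhsNumerator≡-partialBinomialSum {r@(suc r′)} {i@(suc i′)} _ i≤r = begin
    + G                    ≡⟨ cancel (+ G) (+ K) ⟩
    (+ G + + K) - + K
      ≡⟨ cong (λ t → t - + K) (trans (sym (ℤ.pos-+ G K)) (cong +_ (lhsNumerator+partialBinomialSum≡p^[i+r] r i i≤r))) ⟩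
    + (suc r ℕ.^ (i ℕ.+ r)) - + K
                           ≈⟨ +-cong-modℤ (∣⇒≡0-modℤ p*p∣p^[i+r]) (≡-modℤ-refl (- + K)) ⟩
    0ℤ - + K               ≡⟨ ℤ.+-identityˡ (- + K) ⟩
    - + K                  ∎
    where
    open ≡-modℤ-Reasoning (suc r ℕ.* suc r)
    G = lhsNumerator r i
    K = partialBinomialSum r i
    cancel : ∀ g k → g ≡ (g + k) - k
    cancel = solve-∀
    p*p∣p^[i+r] : suc r ℕ.* suc r ∣ suc r ℕ.^ (i ℕ.+ r)
    p*p∣p^[i+r] = subst (λ e → suc r ℕ.* suc r ∣ suc r ℕ.^ e) (cong suc (sym (ℕ.+-suc i′ r′)))
      (p*p∣p^[2+k] (suc r) (i′ ℕ.+ r′))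

  partialBinomialSum[r,1]≡p*p : ∀ r → partialBinomialSum r 1 ≡ suc r ℕ.* suc r
  partialBinomialSum[r,1]≡p*p r = begin
    partialBinomialSum r 1                      ≡⟨ ℕ∑.∑<-suc 1 f ⟩
    f 0 ℕ.+ ℕ∑.∑< 1 (f ∘ suc)                   ≡⟨ cong (f 0 ℕ.+_) (trans (ℕ∑.∑<-suc 0 (f ∘ suc)) (cong (f 1 ℕ.+_) (ℕ∑.∑<-[] _))) ⟩
    f 0 ℕ.+ (f 1 ℕ.+ 0)                         ≡⟨ cong (λ c → f 0 ℕ.+ (c ℕ.* (r ℕ.* 1) ℕ.+ 0)) (nC1≡n (suc (suc r))) ⟩
    1 ℕ.+ (suc (suc r) ℕ.* (r ℕ.* 1) ℕ.+ 0)     ≡⟨ square r ⟩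
    suc r ℕ.* suc r                             ∎
    where
    open ≡-Reasoning
    f : ℕ → ℕ
    f c = ((1 ℕ.+ suc r) C c) ℕ.* r ℕ.^ c
    square : ∀ r → 1 ℕ.+ (suc (suc r) ℕ.* (r ℕ.* 1) ℕ.+ 0) ≡ suc r ℕ.* suc r
    square = ℕSolver.solve-∀
      where import Data.Nat.Tactic.RingSolver as ℕSolver

module Fractions where

  open IntegerCongruence
  open PrimeModulus using (p∤m*n)
  open import Data.Nat as ℕ using (ℕ; zero; suc; _<_; NonZero; s≤s; z≤n; s<s)
  import Data.Nat.Properties as ℕ
  open import Data.Nat.Divisibility using (_∣_; m∣m*n; *-cancelˡ-∣; ∣-trans)
  open import Data.Nat.Primality using (Prime; euclidsLemma; prime⇒nonZero; prime⇒nonTrivial)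
  import Data.Nat.Coprimality as Coprimality
  open import Algebra.Properties.CommutativeSemigroup ℕ.*-commutativeSemigroup using (x∙yz≈y∙xz)
  open import Data.Integer as ℤ using (ℤ; +_; _+_; _*_; -_; _-_; ∣_∣)
  import Data.Integer.Properties as ℤ
  open import Data.Integer.GCD using (gcd)
  open import Data.Integer.Tactic.RingSolver using (solve-∀)
  open import Data.Rational as ℚ using (ℚ; toℚᵘ; mkℚ; ↥_; ↧_; ↧ₙ_)
  import Data.Rational.Properties as ℚ
  open import Data.Rational.Unnormalised as ℚᵘ using (*≡*; _≃_; _/_)
  import Data.Rational.Unnormalised.Properties as ℚᵘ
  open import Data.List using (map; foldr; applyUpTo)
  open import Data.Product using (_×_; _,_)
  open import Data.Sum using (inj₁; inj₂)
  open import Data.Empty using (⊥-elim)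
  open import Function using (_∘_)
  open import Relation.Nullary using (¬_)
  open import Relation.Binary.PropositionalEquality
  open ℤ∑

  toℚᵘ-/ : ∀ a d .{{_ : NonZero d}} → toℚᵘ (a ℚ./ d) ≃ (a / d)
  toℚᵘ-/ a (suc d) = *≡* (begin
    ℚᵘ.↥ (toℚᵘ q) * + suc d   ≡⟨ cong (_* + suc d) (ℚ.↥ᵘ-toℚᵘ q) ⟩
    ↥ q * + suc d             ≡⟨ cong (↥ q *_) (ℚ.↧-/ a (suc d)) ⟨
    ↥ q * (↧ q * g)           ≡⟨ regroup (↥ q) (↧ q) g ⟩
    ↥ q * g * ↧ q             ≡⟨ cong (_* ↧ q) (ℚ.↥-/ a (suc d)) ⟩
    a * ↧ q                   ≡⟨ cong (a *_) (ℚ.↧ᵘ-toℚᵘ q) ⟨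
    a * ℚᵘ.↧ (toℚᵘ q)         ∎)
    where
    open ≡-Reasoning
    q = a ℚ./ suc d
    g = gcd a (+ suc d)
    regroup : ∀ u v g → u * (v * g) ≡ u * g * v
    regroup = solve-∀

  +-/ : ∀ a b d .{{_ : NonZero d}} → (a / d) ℚᵘ.+ (b / d) ≃ ((a + b) / d)
  +-/ a b (suc d) = *≡* (trans (regroup a b (+ suc d)) (cong ((a + b) *_) (sym (ℤ.pos-* (suc d) (suc d)))))
    where
    regroup : ∀ a b s → (a * s + b * s) * s ≡ (a + b) * (s * s)
    regroup = solve-∀

  -‿/ : ∀ a b d e .{{_ : NonZero d}} .{{_ : NonZero e}} .{{_ : NonZero (d ℕ.* e)}} →
    (a / d) ℚᵘ.- (b / e) ≃ ((a * + e - b * + d) / (d ℕ.* e))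
  -‿/ a b (suc d) (suc e) = *≡* (cong (_* + (suc d ℕ.* suc e)) (rearrange a b (+ suc e) (+ suc d)))
    where
    rearrange : ∀ a b e d → a * e + - b * d ≡ a * e - b * d
    rearrange = solve-∀

  *-cancel-/ : ∀ c a d .{{_ : NonZero c}} .{{_ : NonZero d}} .{{_ : NonZero (c ℕ.* d)}} →
    ((+ c * a) / (c ℕ.* d)) ≃ (a / d)
  *-cancel-/ (suc c) a (suc d) = *≡* (trans (regroup (+ suc c) a (+ suc d)) (cong (a *_) (sym (ℤ.pos-* (suc c) (suc d)))))
    where
    regroup : ∀ c a d → c * a * d ≡ a * (c * d)
    regroup = solve-∀

  toℚᵘ-Σℚ : ∀ n (f : ℕ → ℚ) (a : ℕ → ℤ) d .{{_ : NonZero d}} →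
    (∀ j → j < n → toℚᵘ (f j) ≃ (a j / d)) → toℚᵘ (Σℚ[< n ] f) ≃ (∑< n a / d)
  toℚᵘ-Σℚ n f a d@(suc _) = go n (λ j → j) a
    where
    go : ∀ n g (a : ℕ → ℤ) → (∀ j → j < n → toℚᵘ (f (g j)) ≃ (a j / d)) →
      toℚᵘ (foldr ℚ._+_ ℚ.0ℚ (map f (applyUpTo g n))) ≃ (∑< n a / d)
    go zero    g a _ = ℚᵘ.≃-trans {j = ℤ.0ℤ / d} (*≡* refl) (ℚᵘ.≃-reflexive (cong (λ s → s / d) (sym (∑<-[] a))))
    go (suc n) g a f≃a = begin
      toℚᵘ (f (g 0) ℚ.+ foldr ℚ._+_ ℚ.0ℚ (map f (applyUpTo (g ∘ suc) n)))
        ≈⟨ ℚ.toℚᵘ-homo-+ (f (g 0)) _ ⟩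
      toℚᵘ (f (g 0)) ℚᵘ.+ toℚᵘ (foldr ℚ._+_ ℚ.0ℚ (map f (applyUpTo (g ∘ suc) n)))
        ≈⟨ ℚᵘ.+-cong (f≃a 0 (s≤s z≤n)) (go n (g ∘ suc) (a ∘ suc) (λ j j<n → f≃a (suc j) (s<s j<n))) ⟩
      (a 0 / d) ℚᵘ.+ (∑< n (a ∘ suc) / d)
        ≈⟨ +-/ (a 0) _ d ⟩
      ((a 0 + ∑< n (a ∘ suc)) / d)
        ≡⟨ cong (λ s → s / d) (∑<-suc n a) ⟨
      (∑< (suc n) a / d) ∎
      where open ℚᵘ.≃-Reasoning

  toℚᵘ-cross : ∀ z a d .{{_ : NonZero d}} → toℚᵘ z ≃ (a / d) → ↥ z * + d ≡ a * ↧ z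
  toℚᵘ-cross z a (suc d) (*≡* eq) = trans (cong (_* + suc d) (sym (ℚ.↥ᵘ-toℚᵘ z))) (trans eq (cong (a *_) (ℚ.↧ᵘ-toℚᵘ z)))

  fraction∈pℤ₍ₚ₎ : ∀ {p} → Prime p → ∀ z a D m .{{_ : NonZero m}} → toℚᵘ z ≃ (a / m) → m ≡ p ℕ.* D →
    ¬ p ∣ D → a ≡ ℤ.0ℤ [modℤ p ℕ.* p ] → p ∣ ∣ ↥ z ∣ × ¬ p ∣ ↧ₙ z
  fraction∈pℤ₍ₚ₎ {p} p-prime z a D m z≃a/m refl p∤D a≡0 = p∣↥z , p∤↧z
    where
    instance _ = prime⇒nonZero p-prime
    ↥z*pD≡a*↧z : ∣ ↥ z ∣ ℕ.* (p ℕ.* D) ≡ ∣ a ∣ ℕ.* ↧ₙ z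
    ↥z*pD≡a*↧z = trans (sym (ℤ.abs-* (↥ z) (+ (p ℕ.* D)))) (trans (cong ∣_∣ (toℚᵘ-cross z a m z≃a/m)) (ℤ.abs-* a (↧ z)))
    p*p∣p*↥z*D : p ℕ.* p ∣ p ℕ.* (∣ ↥ z ∣ ℕ.* D)
    p*p∣p*↥z*D = subst (p ℕ.* p ∣_) (trans (sym ↥z*pD≡a*↧z) (x∙yz≈y∙xz ∣ ↥ z ∣ p D))
      (∣-trans (≡0-modℤ⇒∣ a≡0) (m∣m*n (↧ₙ z)))
    p∣↥z : p ∣ ∣ ↥ z ∣
    p∣↥z with euclidsLemma ∣ ↥ z ∣ D p-prime (*-cancelˡ-∣ p p*p∣p*↥z*D)
    ... | inj₁ p∣↥z = p∣↥z
    ... | inj₂ p∣D  = ⊥-elim (p∤D p∣D)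
    p∤↧z : ¬ p ∣ ↧ₙ z
    p∤↧z p∣↧z = ℕ.<-irrefl (sym (coprime z (p∣↥z , p∣↧z))) (ℕ.nonTrivial⇒n>1 p {{prime⇒nonTrivial p-prime}})
      where
      coprime : (z : ℚ) → Coprimality.Coprime ∣ ↥ z ∣ (↧ₙ z)
      coprime (mkℚ _ _ c) = Coprimality.recompute c

  fractions-≡-modℚ : ∀ {p} → Prime p → ∀ x y a c m b d .{{_ : NonZero m}} .{{_ : NonZero d}} →
    toℚᵘ x ≃ (a / m) → toℚᵘ y ≃ (c / d) → m ≡ p ℕ.* b → ¬ p ∣ b → ¬ p ∣ d →
    a * + d - c * + m ≡ ℤ.0ℤ [modℤ p ℕ.* p ] → x ≡ y [modℚ p ]
  fractions-≡-modℚ {p} p-prime x y a c m b d x≃a/m y≃c/d m≡pb p∤b p∤d numerator≡0 =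
    fraction∈pℤ₍ₚ₎ p-prime (x ℚ.- y) _ (b ℕ.* d) (m ℕ.* d) difference m*d≡p*[b*d] (p∤m*n p-prime p∤b p∤d) numerator≡0
    where
    instance _ = ℕ.m*n≢0 m d
    m*d≡p*[b*d] : m ℕ.* d ≡ p ℕ.* (b ℕ.* d)
    m*d≡p*[b*d] = trans (cong (ℕ._* d) m≡pb) (ℕ.*-assoc p b d)
    difference : toℚᵘ (x ℚ.- y) ≃ ((a * + d - c * + m) / (m ℕ.* d))
    difference = begin
      toℚᵘ (x ℚ.+ ℚ.- y)             ≈⟨ ℚ.toℚᵘ-homo-+ x (ℚ.- y) ⟩
      toℚᵘ x ℚᵘ.+ toℚᵘ (ℚ.- y)        ≈⟨ ℚᵘ.+-cong x≃a/m (ℚᵘ.≃-trans (ℚ.toℚᵘ-homo‿- y) (ℚᵘ.-‿cong y≃c/d)) ⟩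
      (a / m) ℚᵘ.- (c / d)           ≈⟨ -‿/ a c m d ⟩
      ((a * + d - c * + m) / (m ℕ.* d)) ∎
      where open ℚᵘ.≃-Reasoning

open BinomialCoefficients
open RestrictedStirling
open IntegerCongruence
open PrimeModulus
open WilsonTheorem
open ModPrimeSquare
open Fractions
open import Data.Nat as ℕ using (suc; _!; _<_; _≤_; _∸_; z≤n; s≤s)
import Data.Nat.Properties as ℕ
open import Algebra.Properties.CommutativeSemigroup ℕ.*-commutativeSemigroup using (xy∙z≈y∙xz)
open import Data.Nat.Combinatorics using (_C_)
open import Data.Nat.Divisibility using (_∣_; ∣-refl)
open import Data.Nat.Primality using (Prime; prime⇒nonTrivial)
open import Data.Integer as ℤ using (ℤ; +_; _+_; _*_; -_; _-_; _^_; 0ℤ; 1ℤ; -1ℤ)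
import Data.Integer.Properties as ℤ
open import Data.Integer.Tactic.RingSolver using (solve-∀)
open import Data.Rational as ℚ using (toℚᵘ)
open import Data.Rational.Unnormalised as ℚᵘ using (_≃_; _/_; *≡*)
import Data.Rational.Unnormalised.Properties as ℚᵘ
open import Relation.Nullary using (¬_)
open import Relation.Binary.PropositionalEquality

toℚᵘ-lhs : ∀ r i → toℚᵘ (lhs (suc r) i) ≃ (+ lhsNumerator r i / (i ℕ.+ suc r) !) {{(i ℕ.+ suc r) ℕ.!≢0}}
toℚᵘ-lhs r i = ℚᵘ.≃-trans (toℚᵘ-Σℚ (suc r) (λ j → term (suc r) i (suc j)) a (n !) term≃)
  (ℚᵘ.≃-reflexive (cong (_/ n !) (sym (+-∑< (suc r) _))))
  where
  n = i ℕ.+ suc r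
  instance _ = n ℕ.!≢0
  a : ℕ → ℤ
  a j = + (r ↓ j ℕ.* S≤ r n (suc j))
  term≃ : ∀ j → j < suc r → toℚᵘ (term (suc r) i (suc j)) ≃ (a j / n !)
  term≃ j (s≤s j≤r) = ℚᵘ.≃-trans (toℚᵘ-/ _ ((r ∸ j) ! ℕ.* n !) {{(r ∸ j) ℕ.!* n !≢0}})
    (ℚᵘ.≃-trans (ℚᵘ.≃-reflexive (cong (λ x → (x / ((r ∸ j) ! ℕ.* n !)) {{(r ∸ j) ℕ.!* n !≢0}}) numerator≡))
      (*-cancel-/ ((r ∸ j) !) (a j) (n !) {{(r ∸ j) ℕ.!≢0}} {{_}} {{(r ∸ j) ℕ.!* n !≢0}}))
    where
    numerator≡ : + (r ! ℕ.* S≤ r n (suc j)) ≡ + ((r ∸ j) !) * a j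
    numerator≡ = trans (cong (λ f → + (f ℕ.* S≤ r n (suc j))) (sym (↓-factorial j≤r)))
      (trans (cong +_ (xy∙z≈y∙xz (r ↓ j) ((r ∸ j) !) _)) (ℤ.pos-* ((r ∸ j) !) _))

n!/p : ℕ → ℕ → ℕ
n!/p r i = ((i ℕ.+ suc r) C i) ℕ.* i ! ℕ.* r !

n!≡p*[n!/p] : ∀ r i → (i ℕ.+ suc r) ! ≡ suc r ℕ.* n!/p r i
n!≡p*[n!/p] r i = trans (sym ([a+b]Ca*a!b!≡[a+b]! i (suc r))) (regroup ((i ℕ.+ suc r) C i) (i !) (suc r) (r !))
  where
  regroup : ∀ c f p g → c ℕ.* (f ℕ.* (p ℕ.* g)) ≡ p ℕ.* (c ℕ.* f ℕ.* g)
  regroup = ℕSolver.solve-∀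
    where import Data.Nat.Tactic.RingSolver as ℕSolver

p∤n!/p : ∀ {r i} → Prime (suc r) → i ≤ r → ¬ suc r ∣ n!/p r i
p∤n!/p p-prime i≤r =
  p∤m*n p-prime (p∤m*n p-prime p∤C (p∤k! p-prime (s≤s i≤r))) (p∤k! p-prime ℕ.≤-refl)
  where
  p∤C : ¬ _ ∣ _
  p∤C p∣C = p∤k p-prime (s≤s z≤n) (ℕ.nonTrivial⇒n>1 _ {{prime⇒nonTrivial p-prime}})
    (≡0-modℤ⇒∣ (≡-modℤ-trans (≡-modℤ-sym (C[j+p,j]≡1 p-prime (s≤s i≤r))) (∣⇒≡0-modℤ p∣C)))

n!/p≡-i! : ∀ {r i} → Prime (suc r) → i ≤ r → + n!/p r i ≡ + (i !) * -1ℤ [modℤ suc r ]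
n!/p≡-i! {r} {i} p-prime i≤r = begin
  + n!/p r i
    ≡⟨ trans (ℤ.pos-* (((i ℕ.+ suc r) C i) ℕ.* i !) (r !)) (cong (_* + (r !)) (ℤ.pos-* ((i ℕ.+ suc r) C i) (i !))) ⟩
  + ((i ℕ.+ suc r) C i) * + (i !) * + (r !)  ≈⟨ *-cong-modℤ (*-congʳ-modℤ (+ (i !)) (C[j+p,j]≡1 p-prime (s≤s i≤r))) (wilson p-prime) ⟩
  1ℤ * + (i !) * -1ℤ                         ≡⟨ cong (_* -1ℤ) (ℤ.*-identityˡ (+ (i !))) ⟩
  + (i !) * -1ℤ                              ∎
  where open ≡-modℤ-Reasoning (suc r)

lhsNumerator[r,1]≡0 : ∀ r → 1 ≤ r → + lhsNumerator r 1 ≡ 0ℤ [modℤ suc r ℕ.* suc r ]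
lhsNumerator[r,1]≡0 r 1≤r = begin
  + lhsNumerator r 1               ≈⟨ lhsNumerator≡-partialBinomialSum (s≤s z≤n) 1≤r ⟩
  - + partialBinomialSum r 1       ≡⟨ cong (λ k → - + k) (partialBinomialSum[r,1]≡p*p r) ⟩
  - + (suc r ℕ.* suc r)            ≈⟨ -‿cong-modℤ (∣⇒≡0-modℤ ∣-refl) ⟩
  0ℤ                               ∎
  where open ≡-modℤ-Reasoning (suc r ℕ.* suc r)

i*lhsNumerator≡-[-1]^i*p : ∀ {r i} → Prime (suc r) → 2 ≤ i → i ≤ r →
  + i * + lhsNumerator r i ≡ - (-1ℤ ^ i * + suc r) [modℤ suc r ℕ.* suc r ]
i*lhsNumerator≡-[-1]^i*p {r} {i} p-prime 2≤i i≤r = begin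
  + i * + lhsNumerator r i             ≈⟨ *-congˡ-modℤ (+ i) (lhsNumerator≡-partialBinomialSum (ℕ.<-trans (s≤s z≤n) 2≤i) i≤r) ⟩
  + i * - + partialBinomialSum r i     ≡⟨ ℤ.neg-distribʳ-* (+ i) _ ⟨
  - (+ i * + partialBinomialSum r i)   ≈⟨ -‿cong-modℤ (i*partialBinomialSum≡[-1]^i*p p-prime 2≤i i≤r) ⟩
  - (-1ℤ ^ i * + suc r)                ∎
  where open ≡-modℤ-Reasoning (suc r ℕ.* suc r)

cross-numerator≡0 : ∀ {r i} → Prime (suc r) → 2 ≤ i → i ≤ r →
  + lhsNumerator r i * + (i ! ℕ.* i) - -1ℤ ^ i * + ((i ℕ.+ suc r) !) ≡ 0ℤ [modℤ suc r ℕ.* suc r ]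
cross-numerator≡0 {r} {i} p-prime 2≤i i≤r = begin
  + G * + (i ! ℕ.* i) - -1ℤ ^ i * + ((i ℕ.+ suc r) !)
    ≡⟨ cong₂ (λ x y → + G * x - -1ℤ ^ i * y) (ℤ.pos-* (i !) i) (trans (cong +_ (n!≡p*[n!/p] r i)) (ℤ.pos-* (suc r) _)) ⟩
  + G * (+ (i !) * + i) - -1ℤ ^ i * (P * + n!/p r i)
    ≡⟨ regroup (+ G) (+ (i !)) (+ i) _ ⟩
  + (i !) * (+ i * + G) - -1ℤ ^ i * (P * + n!/p r i)
    ≈⟨ +-cong-modℤ (*-congˡ-modℤ (+ (i !)) (i*lhsNumerator≡-[-1]^i*p p-prime 2≤i i≤r))
                   (-‿cong-modℤ (*-congˡ-modℤ (-1ℤ ^ i) (*-cong-modℤ-scaled (suc r) (n!/p≡-i! p-prime i≤r)))) ⟩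
  + (i !) * - (-1ℤ ^ i * P) - -1ℤ ^ i * (P * (+ (i !) * -1ℤ))
    ≡⟨ cancel (+ (i !)) (-1ℤ ^ i) P ⟩
  0ℤ ∎
  where
  open ≡-modℤ-Reasoning (suc r ℕ.* suc r)
  G = lhsNumerator r i
  P = + suc r
  regroup : ∀ g f i y → g * (f * i) - y ≡ f * (i * g) - y
  regroup = solve-∀
  cancel : ∀ f s p → f * - (s * p) - s * (p * (f * -1ℤ)) ≡ 0ℤ
  cancel = solve-∀

proposition2p8 : (p i : ℕ) → Prime p → 3 ≤ p → 1 ≤ i → i ≤ p ∸ 1 →
    lhs p i ≡ rhs i [modℚ p ]
proposition2p8 (suc r) 1 p-prime _ _ 1≤r =
  fractions-≡-modℚ p-prime (lhs (suc r) 1) (rhs 1) (+ lhsNumerator r 1) 0ℤ ((1 ℕ.+ suc r) !) (n!/p r 1) 1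
    {{(1 ℕ.+ suc r) ℕ.!≢0}} (toℚᵘ-lhs r 1) (*≡* refl) (n!≡p*[n!/p] r 1) (p∤n!/p p-prime 1≤r)
    (p∤k p-prime (s≤s z≤n) (s≤s 1≤r))
    (≡-modℤ-trans (≡⇒≡-modℤ (simplify (+ lhsNumerator r 1) (+ ((1 ℕ.+ suc r) !)))) (lhsNumerator[r,1]≡0 r 1≤r))
  where
  simplify : ∀ g x → g * 1ℤ - 0ℤ * x ≡ g
  simplify = solve-∀
proposition2p8 (suc r) i@(suc (suc _)) p-prime _ _ i≤r =
  fractions-≡-modℚ p-prime (lhs (suc r) i) (rhs i) (+ lhsNumerator r i) (-1ℤ ^ i) ((i ℕ.+ suc r) !) (n!/p r i) (i ! ℕ.* i)
    {{(i ℕ.+ suc r) ℕ.!≢0}} {{i!*i≢0}} (toℚᵘ-lhs r i) (toℚᵘ-/ (-1ℤ ^ i) (i ! ℕ.* i) {{i!*i≢0}})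
    (n!≡p*[n!/p] r i) (p∤n!/p p-prime i≤r)
    (p∤m*n p-prime (p∤k! p-prime (s≤s i≤r)) (p∤k p-prime (s≤s z≤n) (s≤s i≤r)))
    (cross-numerator≡0 p-prime (s≤s (s≤s z≤n)) i≤r)
  where
  i!*i≢0 = ℕ.m*n≢0 (i !) i {{i ℕ.!≢0}}
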